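{- Let $G$ be a finite simple connected graph. Then $G$ is closed if and only if $G$ is chordal, claw-free, and narrow.
   Context: A labeling of a finite simple graph $G$ with $n$ vertices is a bijection $V(G)\to[n]=\{1,\dots,n\}$; given a labeling we identify $V(G)=[n]$. A labeling is closed if whenever $\{j,i\},\{i,k\}$ are distinct edges of $G$ with either ($j>i$ and $k>i$) or ($j<i$ and $k<i$), then $\{j,k\}\in E(G)$. A graph is closed if it has a closed labeling. A graph is chordal if every cycle of length at least $4$ has a chord (an edge joining two non-consecutive vertices of the cycle). A graph is claw-free if it has no induced subgraph isomorphic to the star $K_{1,3}$ (one vertex adjacent to three pairwise non-adjacent vertices). For a connected graph, $d(v,w)$ denotes the length of a shortest path between $v$ and $w$, and $\mathrm{diam}(G)=\max\{d(v,w)\mid v,w\in V(G)\}$. A longest shortest path of $G$ is a shortest path connecting two vertices $v,w$ with $d(v,w)=\mathrm{diam}(G)$. A connected graph $G$ is narrow if for every vertex $v$ and every longest shortest path $P$ of $G$, either $v\in V(P)$ or $v$ is adjacent to some vertex of $P$. -}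

module Defs where

open import Data.Nat using (ℕ; zero; suc; _≤_; _<_)
open import Data.Fin using (Fin; toℕ)
open import Data.Bool using (Bool; true; false)
open import Data.Product using (Σ; ∃; ∃-syntax; _×_; _,_)
open import Data.Sum using (_⊎_)
open import Relation.Nullary using (¬_)
open import Relation.Binary.PropositionalEquality using (_≡_; _≢_)
open import Function.Definitions using (Injective)
open import Data.Fin.Permutation using (Permutation′; _⟨$⟩ʳ_)

record Graph (n : ℕ) : Set where
  field
    adj    : Fin n → Fin n → Bool
    sym    : ∀ u v → adj u v ≡ adj v u
    irrefl : ∀ u → adj u u ≡ false

open Graph public

Edge : ∀ {n} → Graph n → Fin n → Fin n → Set
Edge G u v = adj G u v ≡ true

-- Labelings and closedness.
-- A labeling is a bijection V(G) = Fin n → Fin n (labels 0..n-1 stand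
-- for 1..n; only the order matters).

ClosedLabeling : ∀ {n} → Graph n → Permutation′ n → Set
ClosedLabeling G σ =
  ∀ i j k → Edge G j i → Edge G i k → j ≢ k →
  ((σ ⟨$⟩ʳ j) Data.Fin.> (σ ⟨$⟩ʳ i) × (σ ⟨$⟩ʳ k) Data.Fin.> (σ ⟨$⟩ʳ i))
  ⊎ ((σ ⟨$⟩ʳ j) Data.Fin.< (σ ⟨$⟩ʳ i) × (σ ⟨$⟩ʳ k) Data.Fin.< (σ ⟨$⟩ʳ i)) →
  Edge G j k

IsClosed : ∀ {n} → Graph n → Set
IsClosed {n} G = ∃[ σ ] ClosedLabeling {n} G σ

data Walk {n} (G : Graph n) : Fin n → Fin n → ℕ → Set where
  here : ∀ u → Walk G u u zero
  step : ∀ {u v w ℓ} → Edge G u v → Walk G v w ℓ → Walk G u w (suc ℓ)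

data _∈W_ {n} {G : Graph n} (x : Fin n) : ∀ {u v ℓ} → Walk G u v ℓ → Set where
  at-here : x ∈W here x
  at-head : ∀ {v w ℓ} (e : Edge G x v) (p : Walk G v w ℓ) → x ∈W step e p
  in-tail : ∀ {u v w ℓ} (e : Edge G u v) {p : Walk G v w ℓ} → x ∈W p → x ∈W step e p

Connected : ∀ {n} → Graph n → Set
Connected G = ∀ u v → ∃[ ℓ ] Walk G u v ℓ

IsDist : ∀ {n} → Graph n → Fin n → Fin n → ℕ → Set
IsDist G u v m = Walk G u v m × (∀ ℓ → Walk G u v ℓ → m ≤ ℓ)

IsDiam : ∀ {n} → Graph n → ℕ → Set
IsDiam G D = (∀ u v m → IsDist G u v m → m ≤ D)
           × (∃[ u ] ∃[ v ] IsDist G u v D)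

LongestShortestPath : ∀ {n} (G : Graph n) {u v ℓ} → Walk G u v ℓ → Set
LongestShortestPath G {u} {v} {ℓ} p = IsDist G u v ℓ × IsDiam G ℓ

Narrow : ∀ {n} → Graph n → Set
Narrow G = ∀ {u v ℓ} (p : Walk G u v ℓ) → LongestShortestPath G p →
           ∀ x → x ∈W p ⊎ (∃[ y ] (y ∈W p × Edge G x y))

Next : ∀ {k} → Fin k → Fin k → Set
Next {k} i j = suc (toℕ i) ≡ toℕ j ⊎ (suc (toℕ i) ≡ k × toℕ j ≡ 0)

record Cycle {n} (G : Graph n) (k : ℕ) : Set where
  field
    vtx      : Fin k → Fin n
    distinct : Injective _≡_ _≡_ vtx
    edges    : ∀ i j → Next i j → Edge G (vtx i) (vtx j)

open Cycle public

HasChord : ∀ {n} {G : Graph n} {k} → Cycle G k → Set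
HasChord {G = G} C = ∃[ i ] ∃[ j ]
  (i ≢ j × ¬ Next i j × ¬ Next j i × Edge G (vtx C i) (vtx C j))

Chordal : ∀ {n} → Graph n → Set
Chordal G = ∀ k → 4 ≤ k → (C : Cycle G k) → HasChord C

ClawFree : ∀ {n} → Graph n → Set
ClawFree G = ∀ v a b c →
  ¬ (Edge G v a × Edge G v b × Edge G v c
     × a ≢ b × a ≢ c × b ≢ c
     × ¬ Edge G a b × ¬ Edge G a c × ¬ Edge G b c)

module Submission where

-- A closed labeling is read as a linear order ≺ on the vertices.  Shortest walks are monotone once they
-- start upwards, so every vertex strictly between the ends of an edge is adjacent to both ends.  Closedness
-- at the least vertex of a cycle gives a chord, and at the centre of a claw an edge between two leaves.  A
-- vertex outside the interval spanned by a longest shortest path is adjacent to the nearer end, or it would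
-- reach the other end too quickly; vertices inside the interval are covered by the edge property.
--
-- Conversely, diameter at most 1 means G is complete.  Otherwise let D ≥ 2 be the diameter and u, v a
-- diametral pair.  Among the vertices at distance D from u one of least closed degree is simplicial: claws,
-- chordless 4-, 5- and 6-cycles and narrowness along geodesics from u rule out every other configuration.
-- Measuring distances from that simplicial vertex x₀ (whose eccentricity is D), each distance level is a
-- clique, again by claw-freeness, chordality and narrowness along a geodesic from x₀ to u.  Ordering the
-- vertices by level and, within a level, by (neighbours one level up) − (neighbours one level down), makes
-- every induced path j – i – k monotone through i, which is exactly closedness.

open import Defs hiding (sym; irrefl)
open import Level using (0ℓ)
open import Data.Nat as ℕ using (ℕ; zero; suc; _+_; _*_; _∸_; _≤_; _<_; z≤n; s≤s)
open import Data.Nat.Properties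
open import Data.Fin as Fin using (Fin; toℕ)
import Data.Fin.Properties as Fin
open import Data.Fin.Permutation as Permutation using (Permutation′; _⟨$⟩ʳ_; _⟨$⟩ˡ_; inverseˡ; permutation)
import Data.Bool.Properties as Bool
open import Data.List using (List; filter; cartesianProduct; allFin)
open import Data.List.Relation.Unary.All as All using (All; []; _∷_)
open import Data.List.Membership.Propositional.Properties using (∈-filter⁺; ∈-cartesianProduct⁺; ∈-allFin)
open import Data.Vec using (Vec; lookup; []; _∷_)
open import Data.Product using (Σ-syntax; ∃-syntax; _×_; _,_; proj₁; proj₂; uncurry)
open import Data.Product.Relation.Binary.Lex.Strict using (×-isStrictTotalOrder)
open import Data.Sum using (_⊎_; inj₁; inj₂; swap; [_,_]′)
open import Data.Empty using (⊥; ⊥-elim)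
open import Data.Unit using (⊤; tt)
open import Function using (flip; _∘_)
open import Function.Bundles using (_⇔_; mk⇔)
open import Relation.Nullary using (¬_; Dec; yes; no)
open import Relation.Nullary.Decidable using (True; toWitness; _×-dec_; _⊎-dec_)
open import Relation.Unary using (Decidable; _⊆_)
open import Relation.Binary using (Rel)
open import Relation.Binary.Definitions using (Tri; tri<; tri≈; tri>)
open import Relation.Binary.Structures using (IsStrictTotalOrder)
import Relation.Binary.Construct.Flip.EqAndOrd as Flip
open import Relation.Binary.PropositionalEquality

Least : (ℕ → Set) → Set
Least P = ∃[ m ] P m × (∀ j → P j → m ≤ j)

module _ {P : ℕ → Set} (P? : ∀ k → Dec (P k)) where

  private
    search : ∀ fuel k → (∀ j → j < k → ¬ P j) → P (fuel + k) → Least P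
    search fuel k below p with P? k
    ... | yes pk = k , pk , λ j pj → ≮⇒≥ (λ j<k → below j j<k pj)
    search zero k below p | no ¬pk = ⊥-elim (¬pk p)
    search (suc fuel) k below p | no ¬pk =
      search fuel (suc k) below′ (subst P (sym (+-suc fuel k)) p)
      where
      below′ : ∀ j → j < suc k → ¬ P j
      below′ j j<1+k with m<1+n⇒m<n∨m≡n j<1+k
      ... | inj₁ j<k = below j j<k
      ... | inj₂ refl = ¬pk

  least : ∀ l → P l → Least P
  least l p = search l 0 (λ _ ()) (subst P (sym (+-identityʳ l)) p)

m+[k+[n∸[k+m]]]≡n : ∀ m k {n} → k + m ≤ n → m + (k + (n ∸ (k + m))) ≡ n
m+[k+[n∸[k+m]]]≡n m k {n} k+m≤n =
  trans (trans (sym (+-assoc m k _)) (cong (_+ (n ∸ (k + m))) (+-comm m k))) (m+[n∸m]≡n k+m≤n)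

module Walks {n : ℕ} (G : Graph n) where

  V : Set
  V = Fin n

  E : V → V → Set
  E = Edge G

  W : V → V → ℕ → Set
  W = Walk G

  E-sym : ∀ {u v} → E u v → E v u
  E-sym {u} {v} e = trans (Graph.sym G v u) e

  E⇒≢ : ∀ {u v} → E u v → u ≢ v
  E⇒≢ {u} e refl with trans (sym e) (Graph.irrefl G u)
  ... | ()

  E? : ∀ u v → Dec (E u v)
  E? u v = adj G u v Bool.≟ _

  _++_ : ∀ {u v w l m} → W u v l → W v w m → W u w (l + m)
  here _ ++ q = q
  step e p ++ q = step e (p ++ q)

  _∷ʳ_ : ∀ {u v w l} → W u v l → E v w → W u w (suc l)
  here _ ∷ʳ e = step e (here _)
  step e′ p ∷ʳ e = step e′ (p ∷ʳ e)

  reverse : ∀ {u v l} → W u v l → W v u l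
  reverse (here u) = here u
  reverse (step e p) = reverse p ∷ʳ E-sym e

  Shortest : V → V → ℕ → Set
  Shortest u v l = ∀ m → W u v m → l ≤ m

  shortest-tail : ∀ {u v w l} → E u v → Shortest u w (suc l) → Shortest v w l
  shortest-tail e shortest m p = ≤-pred (shortest (suc m) (step e p))

  shortest-reverse : ∀ {u v l} → Shortest u v l → Shortest v u l
  shortest-reverse shortest m p = shortest m (reverse p)

  W0⇒≡ : ∀ {u v} → W u v 0 → u ≡ v
  W0⇒≡ (here _) = refl

  W1⇒E : ∀ {u v} → W u v 1 → E u v
  W1⇒E (step e (here _)) = e

  start∈ : ∀ {u v l} (p : W u v l) → u ∈W p
  start∈ (here _) = at-here
  start∈ (step e p) = at-head e p

  end∈ : ∀ {u v l} (p : W u v l) → v ∈W p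
  end∈ (here _) = at-here
  end∈ (step e p) = in-tail e (end∈ p)

  ∈-step⁻ : ∀ {x u v w l} (e : E u v) (p : W v w l) → x ∈W step e p → x ≡ u ⊎ x ∈W p
  ∈-step⁻ e p (at-head .e .p) = inj₁ refl
  ∈-step⁻ e p (in-tail .e x∈p) = inj₂ x∈p

  ∈-++⁻ : ∀ {x u v w l m} (p : W u v l) (q : W v w m) → x ∈W (p ++ q) → x ∈W p ⊎ x ∈W q
  ∈-++⁻ (here _) q x∈q = inj₂ x∈q
  ∈-++⁻ (step e p) q (at-head .e .(p ++ q)) = inj₁ (at-head e p)
  ∈-++⁻ (step e p) q (in-tail .e x∈pq) with ∈-++⁻ p q x∈pq
  ... | inj₁ x∈p = inj₁ (in-tail e x∈p)
  ... | inj₂ x∈q = inj₂ x∈q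

  ∈-∷ʳ⁻ : ∀ {x u v w l} (p : W u v l) (e : E v w) → x ∈W (p ∷ʳ e) → x ∈W p ⊎ x ≡ w
  ∈-∷ʳ⁻ (here _) e (at-head .e .(here _)) = inj₁ at-here
  ∈-∷ʳ⁻ (here _) e (in-tail .e at-here) = inj₂ refl
  ∈-∷ʳ⁻ (step e′ p) e (at-head .e′ .(p ∷ʳ e)) = inj₁ (at-head e′ p)
  ∈-∷ʳ⁻ (step e′ p) e (in-tail .e′ x∈pe) with ∈-∷ʳ⁻ p e x∈pe
  ... | inj₁ x∈p = inj₁ (in-tail e′ x∈p)
  ... | inj₂ x≡w = inj₂ x≡w

  -- Positions past the end of the walk all denote its last vertex.
  vertexAt : ∀ {u v l} → W u v l → ℕ → V
  vertexAt {u} (here _) _ = u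
  vertexAt {u} (step _ _) zero = u
  vertexAt (step _ p) (suc k) = vertexAt p k

  vertexAt-zero : ∀ {u v l} (p : W u v l) → vertexAt p 0 ≡ u
  vertexAt-zero (here _) = refl
  vertexAt-zero (step _ _) = refl

  vertexAt-length : ∀ {u v l} (p : W u v l) → vertexAt p l ≡ v
  vertexAt-length (here _) = refl
  vertexAt-length (step _ p) = vertexAt-length p

  vertexAt-edge : ∀ {u v l} (p : W u v l) k → k < l → E (vertexAt p k) (vertexAt p (suc k))
  vertexAt-edge (step e p) zero _ = subst (E _) (sym (vertexAt-zero p)) e
  vertexAt-edge (step e p) (suc k) (s≤s k<l) = vertexAt-edge p k k<l

  vertexAt-∷ʳ : ∀ {u v w l} (p : W u v l) (e : E v w) k → k ≤ l → vertexAt (p ∷ʳ e) k ≡ vertexAt p k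
  vertexAt-∷ʳ (here _) e zero _ = refl
  vertexAt-∷ʳ (step _ p) e zero _ = refl
  vertexAt-∷ʳ (step _ p) e (suc k) (s≤s k≤l) = vertexAt-∷ʳ p e k k≤l

  ∈⇒vertexAt : ∀ {x u v l} (p : W u v l) → x ∈W p → ∃[ t ] t ≤ l × x ≡ vertexAt p t
  ∈⇒vertexAt (here _) at-here = 0 , z≤n , refl
  ∈⇒vertexAt (step e p) x∈ep with ∈-step⁻ e p x∈ep
  ... | inj₁ refl = 0 , z≤n , refl
  ... | inj₂ x∈p with ∈⇒vertexAt p x∈p
  ... | t , t≤l , refl = suc t , s≤s t≤l , refl

  take : ∀ {u v l} (p : W u v l) k → k ≤ l → W u (vertexAt p k) k
  take (here u) zero _ = here u
  take (step e p) zero _ = here _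
  take (step e p) (suc k) (s≤s k≤l) = step e (take p k k≤l)

  drop : ∀ {u v l} (p : W u v l) k → W (vertexAt p k) v (l ∸ k)
  drop (here u) zero = here u
  drop (here u) (suc _) = here u
  drop (step e p) zero = step e p
  drop (step e p) (suc k) = drop p k

  ∈-take⁻ : ∀ {x u v l} (p : W u v l) k (k≤l : k ≤ l) → x ∈W take p k k≤l → ∃[ t ] t ≤ k × x ≡ vertexAt p t
  ∈-take⁻ (here u) zero _ at-here = 0 , z≤n , refl
  ∈-take⁻ (step e p) zero _ at-here = 0 , z≤n , refl
  ∈-take⁻ (step e p) (suc k) (s≤s k≤l) x∈ with ∈-step⁻ e (take p k k≤l) x∈
  ... | inj₁ refl = 0 , z≤n , refl
  ... | inj₂ x∈take with ∈-take⁻ p k k≤l x∈take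
  ... | t , t≤k , refl = suc t , s≤s t≤k , refl

  ∈-drop⁻ : ∀ {x u v l} (p : W u v l) k → k ≤ l → x ∈W drop p k → ∃[ t ] k ≤ t × t ≤ l × x ≡ vertexAt p t
  ∈-drop⁻ (here u) zero _ at-here = 0 , z≤n , z≤n , refl
  ∈-drop⁻ (step e p) zero _ x∈ with ∈⇒vertexAt (step e p) x∈
  ... | t , t≤l , x≡ = t , z≤n , t≤l , x≡
  ∈-drop⁻ (step e p) (suc k) (s≤s k≤l) x∈ with ∈-drop⁻ p k k≤l x∈
  ... | t , k≤t , t≤l , x≡ = suc t , s≤s k≤t , s≤s t≤l , x≡

module Distances {n : ℕ} {G : Graph n} (connected : Connected G) where

  open Walks G

  walk? : ∀ l u v → Dec (W u v l)
  walk? zero u v with u Fin.≟ v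
  ... | yes refl = yes (here u)
  ... | no u≢v = no λ p → u≢v (W0⇒≡ p)
  walk? (suc l) u v with Fin.any? (λ w → E? u w ×-dec walk? l w v)
  ... | yes (w , e , p) = yes (step e p)
  ... | no ∄w = no λ { (step {v = w} e p) → ∄w (w , e , p) }

  private abstract
    shortest-walk : ∀ u v → Least (W u v)
    shortest-walk u v = least (λ l → walk? l u v) (proj₁ (connected u v)) (proj₂ (connected u v))

  d : V → V → ℕ
  d u v = proj₁ (shortest-walk u v)

  geodesic : ∀ u v → W u v (d u v)
  geodesic u v = proj₁ (proj₂ (shortest-walk u v))

  d-minimal : ∀ {u v l} → W u v l → d u v ≤ l
  d-minimal p = proj₂ (proj₂ (shortest-walk _ _)) _ p

  geodesic-shortest : ∀ u v → Shortest u v (d u v)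
  geodesic-shortest u v _ = d-minimal

  d-isDist : ∀ u v → IsDist G u v (d u v)
  d-isDist u v = geodesic u v , geodesic-shortest u v

  isDist⇒≡d : ∀ {u v m} → IsDist G u v m → d u v ≡ m
  isDist⇒≡d (p , minimal) = ≤-antisym (d-minimal p) (minimal _ (geodesic _ _))

  diameter-bound : ∀ {D} → IsDiam G D → ∀ a b → d a b ≤ D
  diameter-bound (bounded , _) a b = bounded a b (d a b) (d-isDist a b)

  d-sym : ∀ u v → d u v ≡ d v u
  d-sym u v = ≤-antisym (d-minimal (reverse (geodesic v u))) (d-minimal (reverse (geodesic u v)))

  d-triangle : ∀ u v w → d u w ≤ d u v + d v w
  d-triangle u v w = d-minimal (geodesic u v ++ geodesic v w)

  d≡0⇒≡ : ∀ {u v} → d u v ≡ 0 → u ≡ v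
  d≡0⇒≡ {u} {v} eq = W0⇒≡ (subst (W u v) eq (geodesic u v))

  d≡1⇒E : ∀ {u v} → d u v ≡ 1 → E u v
  d≡1⇒E {u} {v} eq = W1⇒E (subst (W u v) eq (geodesic u v))

  d-edge : ∀ {u v} → E u v → d u v ≤ 1
  d-edge e = d-minimal (step e (here _))

  d-vertexAt-geodesic : ∀ {u v l} (p : W u v l) → d u v ≡ l → ∀ k → k ≤ l → d u (vertexAt p k) ≡ k
  d-vertexAt-geodesic {u} {v} {l} p dp k k≤l = ≤-antisym (d-minimal (take p k k≤l)) k≤d
    where
    x : V
    x = vertexAt p k
    l≤dx+l∸k : l ≤ d u x + (l ∸ k)
    l≤dx+l∸k = subst (_≤ d u x + (l ∸ k)) dp (d-minimal (geodesic u x ++ drop p k))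
    k≤d : k ≤ d u x
    k≤d = begin
      k                         ≡⟨ m∸[m∸n]≡n k≤l ⟨
      l ∸ (l ∸ k)               ≤⟨ ∸-monoˡ-≤ (l ∸ k) l≤dx+l∸k ⟩
      d u x + (l ∸ k) ∸ (l ∸ k) ≡⟨ m+n∸n≡m (d u x) (l ∸ k) ⟩
      d u x                     ∎
      where open ≤-Reasoning

pullback : ∀ {A B : Set} {_≈_ _<_ : Rel B 0ℓ} (f : A → B) → (∀ {a b} → f a ≈ f b → a ≡ b) →
           IsStrictTotalOrder _≈_ _<_ → IsStrictTotalOrder _≡_ (λ a b → f a < f b)
pullback {_≈_ = _≈_} {_<_} f injective order = record
  { isStrictPartialOrder = record
    { isEquivalence = isEquivalence
    ; irrefl = λ { refl → irrefl Eq.refl }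
    ; trans = transitive
    ; <-resp-≈ = (λ { refl → λ h → h }) , (λ { refl → λ h → h })
    }
  ; compare = λ a b → compareBy (compare (f a) (f b))
  }
  where
  open IsStrictTotalOrder order using (compare; irrefl; module Eq) renaming (trans to transitive)
  compareBy : ∀ {a b} → Tri (f a < f b) (f a ≈ f b) (f b < f a) → Tri (f a < f b) (a ≡ b) (f b < f a)
  compareBy (tri< lt ≉ ≯) = tri< lt (≉ ∘ λ { refl → Eq.refl }) ≯
  compareBy (tri≈ ≮ ≈ ≯) = tri≈ ≮ (injective ≈) ≯
  compareBy (tri> ≮ ≉ gt) = tri> ≮ (≉ ∘ λ { refl → Eq.refl }) gt

module _ {A : Set} {_≺_ : A → A → Set} (order : IsStrictTotalOrder _≡_ _≺_) where

  open IsStrictTotalOrder order using (compare; irrefl; asym) renaming (trans to ≺-trans)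

  argmin : ∀ {k} → Fin k → (f : Fin k → A) → ∃[ i ] ∀ j → ¬ f j ≺ f i
  argmin {suc k} _ f = minimum f
    where
    minimum : ∀ {k} (f : Fin (suc k) → A) → ∃[ i ] ∀ j → ¬ f j ≺ f i
    minimum {zero} f = Fin.zero , λ { Fin.zero → irrefl refl }
    minimum {suc k} f with minimum (f ∘ Fin.suc)
    ... | i , minimal with compare (f Fin.zero) (f (Fin.suc i))
    ... | tri< 0≺i _ _ = Fin.zero , λ { Fin.zero → irrefl refl ; (Fin.suc j) j≺0 → minimal j (≺-trans j≺0 0≺i) }
    ... | tri≈ _ 0≡i _ =
      Fin.zero , λ { Fin.zero → irrefl refl ; (Fin.suc j) j≺0 → minimal j (subst (f (Fin.suc j) ≺_) 0≡i j≺0) }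
    ... | tri> _ _ i≺0 = Fin.suc i , λ { Fin.zero 0≺i → asym 0≺i i≺0 ; (Fin.suc j) → minimal j }

count : ∀ {m} {P : Fin m → Set} → Decidable P → ℕ
count {zero} P? = 0
count {suc m} P? with P? Fin.zero
... | yes _ = suc (count (P? ∘ Fin.suc))
... | no _ = count (P? ∘ Fin.suc)

count-mono : ∀ {m} {P Q : Fin m → Set} (P? : Decidable P) (Q? : Decidable Q) → P ⊆ Q → count P? ≤ count Q?
count-mono {zero} _ _ _ = z≤n
count-mono {suc m} P? Q? P⊆Q with P? Fin.zero | Q? Fin.zero
... | yes _ | yes _ = s≤s (count-mono (P? ∘ Fin.suc) (Q? ∘ Fin.suc) P⊆Q)
... | yes p | no ¬q = ⊥-elim (¬q (P⊆Q p))
... | no _ | yes _ = m≤n⇒m≤1+n (count-mono (P? ∘ Fin.suc) (Q? ∘ Fin.suc) P⊆Q)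
... | no _ | no _ = count-mono (P? ∘ Fin.suc) (Q? ∘ Fin.suc) P⊆Q

count-strict : ∀ {m} {P Q : Fin m → Set} (P? : Decidable P) (Q? : Decidable Q) → P ⊆ Q →
               ∀ {j} → Q j → ¬ P j → count P? < count Q?
count-strict {suc m} P? Q? P⊆Q {Fin.zero} qj ¬pj with P? Fin.zero | Q? Fin.zero
... | yes pj | _ = ⊥-elim (¬pj pj)
... | no _ | yes _ = s≤s (count-mono (P? ∘ Fin.suc) (Q? ∘ Fin.suc) P⊆Q)
... | no _ | no ¬qj = ⊥-elim (¬qj qj)
count-strict {suc m} P? Q? P⊆Q {Fin.suc j} qj ¬pj with P? Fin.zero | Q? Fin.zero
... | yes _ | yes _ = s≤s (count-strict (P? ∘ Fin.suc) (Q? ∘ Fin.suc) P⊆Q qj ¬pj)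
... | yes p | no ¬q = ⊥-elim (¬q (P⊆Q p))
... | no _ | yes _ = m≤n⇒m≤1+n (count-strict (P? ∘ Fin.suc) (Q? ∘ Fin.suc) P⊆Q qj ¬pj)
... | no _ | no _ = count-strict (P? ∘ Fin.suc) (Q? ∘ Fin.suc) P⊆Q qj ¬pj

count-all : ∀ m → count {m} {λ _ → ⊤} (λ _ → yes tt) ≡ m
count-all zero = refl
count-all (suc m) = cong suc (count-all m)

count<size : ∀ {m} {P : Fin m → Set} (P? : Decidable P) {j} → ¬ P j → count P? < m
count<size {m} P? ¬pj = subst (count P? <_) (count-all m) (count-strict P? (λ _ → yes tt) (λ _ → tt) tt ¬pj)

count≤size : ∀ {m} {P : Fin m → Set} (P? : Decidable P) → count P? ≤ m
count≤size {m} P? = subst (count P? ≤_) (count-all m) (count-mono P? (λ _ → yes tt) (λ _ → tt))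

injective⇒surjective : ∀ {m} (f : Fin m → Fin m) → (∀ {a b} → f a ≡ f b → a ≡ b) → ∀ y → ∃[ x ] f x ≡ y
injective⇒surjective {suc m} f injective y with Fin.any? (λ x → f x Fin.≟ y)
... | yes hit = hit
... | no miss = ⊥-elim (<-irrefl refl (Fin.injective⇒≤ avoid-injective))
  where
  avoid : Fin (suc m) → Fin m
  avoid x = Fin.punchOut {i = y} (λ y≡fx → miss (x , sym y≡fx))
  avoid-injective : ∀ {a b} → avoid a ≡ avoid b → a ≡ b
  avoid-injective {a} {b} eq =
    injective (Fin.punchOut-injective {i = y} (λ y≡fa → miss (a , sym y≡fa)) (λ y≡fb → miss (b , sym y≡fb)) eq)

injective⇒permutation : ∀ {m} (f : Fin m → Fin m) → (∀ {a b} → f a ≡ f b → a ≡ b) →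
                        Σ[ σ ∈ Permutation′ m ] (∀ a → σ ⟨$⟩ʳ a ≡ f a)
injective⇒permutation f injective =
  permutation f (proj₁ ∘ onto) (proj₂ ∘ onto) (λ x → injective (proj₂ (onto (f x)))) , λ _ → refl
  where
  onto : ∀ y → ∃[ x ] f x ≡ y
  onto = injective⇒surjective f injective

module _ {m} {_≺_ : Fin m → Fin m → Set} (order : IsStrictTotalOrder _≡_ _≺_) where

  open IsStrictTotalOrder order using (compare; irrefl) renaming (trans to ≺-trans; _<?_ to _≺?_)

  rank : Fin m → ℕ
  rank a = count (_≺? a)

  rank-mono : ∀ {a b} → a ≺ b → rank a < rank b
  rank-mono {a} {b} a≺b = count-strict (_≺? a) (_≺? b) (λ x≺a → ≺-trans x≺a a≺b) a≺b (irrefl refl)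

  rank<size : ∀ a → rank a < m
  rank<size a = count<size (_≺? a) (irrefl refl)

  rank-injective : ∀ {a b} → rank a ≡ rank b → a ≡ b
  rank-injective {a} {b} eq with compare a b
  ... | tri< a≺b _ _ = ⊥-elim (<-irrefl eq (rank-mono a≺b))
  ... | tri≈ _ a≡b _ = a≡b
  ... | tri> _ _ b≺a = ⊥-elim (<-irrefl (sym eq) (rank-mono b≺a))

  private
    position : Fin m → Fin m
    position a = Fin.fromℕ< (rank<size a)

    toℕ-position : ∀ a → toℕ (position a) ≡ rank a
    toℕ-position a = Fin.toℕ-fromℕ< (rank<size a)

    position-injective : ∀ {a b} → position a ≡ position b → a ≡ b
    position-injective {a} {b} eq =
      rank-injective (trans (sym (toℕ-position a)) (trans (cong toℕ eq) (toℕ-position b)))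

  -- Abstract: unfolding the permutation while checking its uses is prohibitively expensive.
  abstract
    linearization : Σ[ σ ∈ Permutation′ m ] (∀ {a b} → a ≺ b → σ ⟨$⟩ʳ a Fin.< σ ⟨$⟩ʳ b)
    linearization = proj₁ permuted , λ {a} {b} a≺b → subst₂ _<_ (sym (toℕ-σ a)) (sym (toℕ-σ b)) (rank-mono a≺b)
      where
      permuted : Σ[ σ ∈ Permutation′ m ] (∀ a → σ ⟨$⟩ʳ a ≡ position a)
      permuted = injective⇒permutation position position-injective
      toℕ-σ : ∀ a → toℕ (proj₁ permuted ⟨$⟩ʳ a) ≡ rank a
      toℕ-σ a = trans (cong toℕ (proj₂ permuted a)) (toℕ-position a)

CyclicSucc : ℕ → ℕ → ℕ → Set
CyclicSucc k a b = suc a ≡ b ⊎ (suc a ≡ k × b ≡ 0)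

successor : ∀ {k} (i : Fin k) → ∃[ j ] Next i j
successor {suc k} i with suc (toℕ i) ℕ.<? suc k
... | yes i+1<k = Fin.fromℕ< i+1<k , inj₁ (sym (Fin.toℕ-fromℕ< i+1<k))
... | no i+1≮k = Fin.zero , inj₂ (≤-antisym (Fin.toℕ<n i) (≮⇒≥ i+1≮k) , refl)

predecessor : ∀ {k} (j : Fin k) → ∃[ i ] Next i j
predecessor {suc k} j with toℕ j in eq
... | zero = Fin.fromℕ k , inj₂ (cong suc (Fin.toℕ-fromℕ k) , refl)
... | suc t = Fin.fromℕ< t<1+k , inj₁ (cong suc (Fin.toℕ-fromℕ< t<1+k))
  where
  t<1+k : t < suc k
  t<1+k = ≤-trans (n≤1+n _) (subst (_< suc k) eq (Fin.toℕ<n j))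

private
  ≥4⇒≢ : ∀ {k} → 4 ≤ k → ∀ j {j<4 : True (j ℕ.<? 4)} → j ≢ k
  ≥4⇒≢ k≥4 j {j<4} refl = <⇒≱ (toWitness j<4) k≥4

two-apart : ∀ {k a b c} → 4 ≤ k → CyclicSucc k a b → CyclicSucc k b c →
            a ≢ c × ¬ CyclicSucc k a c × ¬ CyclicSucc k c a
two-apart {k} {a} k≥4 (inj₁ refl) (inj₁ refl) =
  m≢1+n+m a ,
  (λ { (inj₁ eq) → 1+n≢n (sym eq) ; (inj₂ (_ , ())) }) ,
  (λ { (inj₁ eq) → m≢1+n+m a (sym eq) ; (inj₂ (eq , refl)) → ≥4⇒≢ k≥4 3 eq })
two-apart {k} {a} k≥4 (inj₁ refl) (inj₂ (a+2≡k , refl)) =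
  (λ { refl → ≥4⇒≢ k≥4 2 a+2≡k }) ,
  (λ { (inj₁ ()) ; (inj₂ (a+1≡k , _)) → 1+n≢n (trans a+2≡k (sym a+1≡k)) }) ,
  (λ { (inj₁ refl) → ≥4⇒≢ k≥4 3 a+2≡k ; (inj₂ (1≡k , _)) → ≥4⇒≢ k≥4 1 1≡k })
two-apart {k} {a} k≥4 (inj₂ (a+1≡k , refl)) (inj₁ refl) =
  (λ { refl → ≥4⇒≢ k≥4 2 a+1≡k }) ,
  (λ { (inj₁ refl) → ≥4⇒≢ k≥4 1 a+1≡k ; (inj₂ (_ , ())) }) ,
  (λ { (inj₁ refl) → ≥4⇒≢ k≥4 3 a+1≡k ; (inj₂ (2≡k , _)) → ≥4⇒≢ k≥4 2 2≡k })
two-apart k≥4 (inj₂ (_ , refl)) (inj₂ (1≡k , refl)) = ⊥-elim (≥4⇒≢ k≥4 1 1≡k)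

module _ {k : ℕ} where

  -- Positions a < b of a k-cycle that are not cyclically consecutive.
  Gap : ℕ → ℕ → Set
  Gap a b = 2 + a ≤ b × 2 + b ≤ k + a

  consecutive? : (ij : Fin k × Fin k) → Dec (uncurry Next ij)
  consecutive? (i , j) = (suc (toℕ i) ℕ.≟ toℕ j) ⊎-dec ((suc (toℕ i) ℕ.≟ k) ×-dec (toℕ j ℕ.≟ 0))

  gap? : (ij : Fin k × Fin k) → Dec (Gap (toℕ (proj₁ ij)) (toℕ (proj₂ ij)))
  gap? (i , j) = (2 + toℕ i ℕ.≤? toℕ j) ×-dec (2 + toℕ j ℕ.≤? k + toℕ i)

  private
    pairs : List (Fin k × Fin k)
    pairs = cartesianProduct (allFin k) (allFin k)

  consecutivePairs nonConsecutivePairs : List (Fin k × Fin k)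
  consecutivePairs = filter consecutive? pairs
  nonConsecutivePairs = filter gap? pairs

  lookup-filtered-pairs : ∀ {P Q : Fin k × Fin k → Set} (Q? : Decidable Q) →
                          All P (filter Q? pairs) → ∀ i j → Q (i , j) → P (i , j)
  lookup-filtered-pairs Q? all i j q =
    All.lookup all (∈-filter⁺ Q? (∈-cartesianProduct⁺ (∈-allFin i) (∈-allFin j)) q)

  private
    ordered⇒gap : ∀ {a b} → a < b → b < k → suc a ≢ b → ¬ (suc b ≡ k × a ≡ 0) → Gap a b
    ordered⇒gap {a} {b} a<b b<k a+1≢b ¬wrap = ≤∧≢⇒< a<b a+1≢b , wrapped a ¬wrap
      where
      wrapped : ∀ a → ¬ (suc b ≡ k × a ≡ 0) → 2 + b ≤ k + a
      wrapped zero ¬wrap = subst (2 + b ≤_) (sym (+-identityʳ k)) (≤∧≢⇒< b<k (λ eq → ¬wrap (eq , refl)))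
      wrapped (suc a) _ = subst (2 + b ≤_) (sym (+-suc k a)) (s≤s (≤-trans b<k (m≤m+n k a)))

  nonconsecutive⇒gap : ∀ {i j : Fin k} → i ≢ j → ¬ Next i j → ¬ Next j i →
                       Gap (toℕ i) (toℕ j) ⊎ Gap (toℕ j) (toℕ i)
  nonconsecutive⇒gap {i} {j} i≢j ¬i→j ¬j→i with ℕ.<-cmp (toℕ i) (toℕ j)
  ... | tri< i<j _ _ = inj₁ (ordered⇒gap i<j (Fin.toℕ<n j) (¬i→j ∘ inj₁) (¬j→i ∘ inj₂))
  ... | tri≈ _ i≡j _ = ⊥-elim (i≢j (Fin.toℕ-injective i≡j))
  ... | tri> _ _ j<i = inj₂ (ordered⇒gap j<i (Fin.toℕ<n i) (¬j→i ∘ inj₁) (¬i→j ∘ inj₂))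

ClosedOrder : ∀ {n} → Graph n → (Fin n → Fin n → Set) → Set
ClosedOrder G _≺_ = ∀ i j k → Edge G j i → Edge G i k → j ≢ k →
  (i ≺ j × i ≺ k) ⊎ (j ≺ i × k ≺ i) → Edge G j k

labelOrder : ∀ {n} (σ : Permutation′ n) → IsStrictTotalOrder _≡_ (λ a b → σ ⟨$⟩ʳ a Fin.< σ ⟨$⟩ʳ b)
labelOrder σ = pullback (σ ⟨$⟩ʳ_) σ-injective Fin.<-isStrictTotalOrder
  where
  σ-injective : ∀ {a b} → σ ⟨$⟩ʳ a ≡ σ ⟨$⟩ʳ b → a ≡ b
  σ-injective {a} {b} eq = trans (sym (inverseˡ σ)) (trans (cong (σ ⟨$⟩ˡ_) eq) (inverseˡ σ))

record ClosedLinearOrder {n} (G : Graph n) : Set₁ where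
  field
    _≺_ : Fin n → Fin n → Set
    isStrictTotalOrder : IsStrictTotalOrder _≡_ _≺_
    closed : ClosedOrder G _≺_

  open IsStrictTotalOrder isStrictTotalOrder public
    using (compare; irrefl; asym) renaming (trans to ≺-trans)

  ≺⇒≢ : ∀ {a b} → a ≺ b → a ≢ b
  ≺⇒≢ a≺b a≡b = irrefl a≡b a≺b

  ≻⇒≢ : ∀ {a b} → b ≺ a → a ≢ b
  ≻⇒≢ b≺a a≡b = irrefl (sym a≡b) b≺a

labelingOrder : ∀ {n} {G : Graph n} → IsClosed G → ClosedLinearOrder G
labelingOrder (σ , closed) = record { isStrictTotalOrder = labelOrder σ ; closed = closed }

reverseOrder : ∀ {n} {G : Graph n} → ClosedLinearOrder G → ClosedLinearOrder G
reverseOrder O = record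
  { _≺_ = flip _≺_
  ; isStrictTotalOrder = Flip.isStrictTotalOrder isStrictTotalOrder
  ; closed = λ i j k eji eik j≢k → closed i j k eji eik j≢k ∘ swap
  }
  where open ClosedLinearOrder O

module MonotoneShortestWalks {n} {G : Graph n} (O : ClosedLinearOrder G) where

  open Walks G
  open ClosedLinearOrder O

  -- A downward turn at w₁ would make u w₂ an edge by closedness, shortening the walk.
  ascends : ∀ {u w₁ w₂ v l} (e : E u w₁) (e′ : E w₁ w₂) (p : W w₂ v l) →
            Shortest u v (suc (suc l)) → u ≺ w₁ → w₁ ≺ w₂
  ascends {u} {w₁} {w₂} e e′ p shortest u≺w₁ with u Fin.≟ w₂
  ... | yes refl = ⊥-elim (<⇒≱ (≤-trans (n<1+n _) (n≤1+n _)) (shortest _ p))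
  ... | no u≢w₂ with compare w₁ w₂
  ... | tri< w₁≺w₂ _ _ = w₁≺w₂
  ... | tri≈ _ w₁≡w₂ _ = ⊥-elim (E⇒≢ e′ w₁≡w₂)
  ... | tri> _ _ w₂≺w₁ =
    ⊥-elim (<⇒≱ (n<1+n _) (shortest _ (step (closed w₁ u w₂ e e′ u≢w₂ (inj₂ (u≺w₁ , w₂≺w₁))) p)))

  increasing : ∀ {u w v l} (e : E u w) (p : W w v l) → Shortest u v (suc l) → u ≺ w → u ≺ v
  increasing e (here _) _ u≺w = u≺w
  increasing e (step e′ p) shortest u≺w =
    ≺-trans u≺w (increasing e′ p (shortest-tail e shortest) (ascends e e′ p shortest u≺w))

module EdgeIntervals {n} {G : Graph n} (O : ClosedLinearOrder G) where

  open Walks G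
  open ClosedLinearOrder O
  open MonotoneShortestWalks O
  private module Down = MonotoneShortestWalks (reverseOrder O)

  first-step-descends : ∀ {c w a l} (e : E c w) (p : W w a l) → Shortest c a (suc l) → a ≺ c → w ≺ c
  first-step-descends e p shortest a≺c with compare _ _
  ... | tri< w≺c _ _ = w≺c
  ... | tri≈ _ w≡c _ = ⊥-elim (E⇒≢ e (sym w≡c))
  ... | tri> _ _ c≺w = ⊥-elim (asym a≺c (increasing e p shortest c≺w))

  -- A shortest walk from c to a keeps descending; closedness closes it up if it has length 2,
  -- and longer ones are shortcut by induction.
  between⇒adjacent-to-lower : ∀ {a b c m} (q : W c a m) → Shortest c a m → E a b → a ≺ c → c ≺ b → E c a
  between⇒adjacent-to-lower (here _) _ _ a≺c _ = ⊥-elim (irrefl refl a≺c)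
  between⇒adjacent-to-lower (step e (here _)) _ _ _ _ = e
  between⇒adjacent-to-lower {a} {b} {c} (step {v = w} e₁ (step e₂ (here _))) shortest eab a≺c c≺b =
    closed b c a ecb (E-sym eab) (≻⇒≢ a≺c) (inj₂ (c≺b , a≺b))
    where
    a≺b : a ≺ b
    a≺b = ≺-trans a≺c c≺b
    w≺c : w ≺ c
    w≺c = first-step-descends e₁ (step e₂ (here _)) shortest a≺c
    a≺w : a ≺ w
    a≺w = Down.ascends e₁ e₂ (here _) shortest w≺c
    ewb : E w b
    ewb = closed a w b e₂ eab (≺⇒≢ (≺-trans w≺c c≺b)) (inj₁ (a≺w , a≺b))
    ecb : E c b
    ecb = closed w c b e₁ ewb (≺⇒≢ c≺b) (inj₁ (w≺c , ≺-trans w≺c c≺b))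
  between⇒adjacent-to-lower {a} {b} {c} {suc (suc (suc l))} (step {v = w₁} e₁ (step {v = w₂} e₂ (step e₃ p))) shortest eab a≺c c≺b =
    let ew₁a = between⇒adjacent-to-lower (step e₂ (step e₃ p)) tail-shortest eab a≺w₁ (≺-trans w₁≺c c≺b)
    in ⊥-elim (<⇒≱ (s≤s (s≤s z≤n)) (tail-shortest 1 (step ew₁a (here _))))
    where
    tail-shortest : Shortest w₁ a (suc (suc l))
    tail-shortest = shortest-tail e₁ shortest
    w₁≺c : w₁ ≺ c
    w₁≺c = first-step-descends e₁ (step e₂ (step e₃ p)) shortest a≺c
    w₂≺w₁ : w₂ ≺ w₁
    w₂≺w₁ = Down.ascends e₁ e₂ (step e₃ p) shortest w₁≺c
    a≺w₁ : a ≺ w₁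
    a≺w₁ = Down.increasing e₂ (step e₃ p) tail-shortest w₂≺w₁

module ChordalityAndClawFreeness {n} {G : Graph n} (O : ClosedLinearOrder G) where

  open Walks G
  open ClosedLinearOrder O

  neighbour-comparable : ∀ {v x} → E v x → x ≺ v ⊎ v ≺ x
  neighbour-comparable {v} {x} e with compare x v
  ... | tri< x≺v _ _ = inj₁ x≺v
  ... | tri≈ _ x≡v _ = ⊥-elim (E⇒≢ e (sym x≡v))
  ... | tri> _ _ v≺x = inj₂ v≺x

  closed⇒clawFree : ClawFree G
  closed⇒clawFree v a b c (eva , evb , evc , a≢b , a≢c , b≢c , ¬ab , ¬ac , ¬bc) =
    two-on-one-side (neighbour-comparable eva) (neighbour-comparable evb) (neighbour-comparable evc)
    where
    adjacent : ∀ {x y} → E v x → E v y → x ≢ y → (v ≺ x × v ≺ y) ⊎ (x ≺ v × y ≺ v) → E x y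
    adjacent ex ey x≢y = closed v _ _ (E-sym ex) ey x≢y
    two-on-one-side : a ≺ v ⊎ v ≺ a → b ≺ v ⊎ v ≺ b → c ≺ v ⊎ v ≺ c → ⊥
    two-on-one-side (inj₁ a≺v) (inj₁ b≺v) _ = ¬ab (adjacent eva evb a≢b (inj₂ (a≺v , b≺v)))
    two-on-one-side (inj₂ v≺a) (inj₂ v≺b) _ = ¬ab (adjacent eva evb a≢b (inj₁ (v≺a , v≺b)))
    two-on-one-side (inj₁ a≺v) _ (inj₁ c≺v) = ¬ac (adjacent eva evc a≢c (inj₂ (a≺v , c≺v)))
    two-on-one-side (inj₂ v≺a) _ (inj₂ v≺c) = ¬ac (adjacent eva evc a≢c (inj₁ (v≺a , v≺c)))
    two-on-one-side _ (inj₁ b≺v) (inj₁ c≺v) = ¬bc (adjacent evb evc b≢c (inj₂ (b≺v , c≺v)))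
    two-on-one-side _ (inj₂ v≺b) (inj₂ v≺c) = ¬bc (adjacent evb evc b≢c (inj₁ (v≺b , v≺c)))

  closed⇒chordal : Chordal G
  closed⇒chordal (suc k) k≥4 C =
    h , j , h≢j , ¬h→j , ¬j→h ,
    closed (vtx C m) (vtx C h) (vtx C j) ehm emj (h≢j ∘ distinct C) (inj₁ (above (E-sym ehm) , above emj))
    where
    minimum : ∃[ i ] ∀ j → ¬ vtx C j ≺ vtx C i
    minimum = argmin isStrictTotalOrder Fin.zero (vtx C)
    m h j : Fin (suc k)
    m = proj₁ minimum
    h = proj₁ (predecessor m)
    j = proj₁ (successor m)
    ehm : E (vtx C h) (vtx C m)
    ehm = edges C h m (proj₂ (predecessor m))
    emj : E (vtx C m) (vtx C j)
    emj = edges C m j (proj₂ (successor m))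
    apart : toℕ h ≢ toℕ j × ¬ Next h j × ¬ Next j h
    apart = two-apart k≥4 (proj₂ (predecessor m)) (proj₂ (successor m))
    h≢j : h ≢ j
    h≢j = proj₁ apart ∘ cong toℕ
    ¬h→j : ¬ Next h j
    ¬h→j = proj₁ (proj₂ apart)
    ¬j→h : ¬ Next j h
    ¬j→h = proj₂ (proj₂ apart)
    above : ∀ {x} → E (vtx C m) (vtx C x) → vtx C m ≺ vtx C x
    above {x} e with neighbour-comparable e
    ... | inj₁ x≺m = ⊥-elim (proj₂ minimum x x≺m)
    ... | inj₂ m≺x = m≺x

module Covering {n} {G : Graph n} (O : ClosedLinearOrder G) (connected : Connected G) where

  open Walks G
  open Distances connected
  open ClosedLinearOrder O
  private module Up = EdgeIntervals O
  private module Down = EdgeIntervals (reverseOrder O)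

  between-edge⇒adjacent : ∀ {a b c} → E a b → a ≺ c → c ≺ b → E c a × E c b
  between-edge⇒adjacent {a} {b} {c} eab a≺c c≺b =
    Up.between⇒adjacent-to-lower (geodesic c a) (geodesic-shortest c a) eab a≺c c≺b ,
    Down.between⇒adjacent-to-lower (geodesic c b) (geodesic-shortest c b) (E-sym eab) c≺b a≺c

  between⇒covered : ∀ {u v l x} (p : W u v l) → Shortest u v l → u ≺ x → x ≺ v →
                    x ∈W p ⊎ ∃[ y ] y ∈W p × E x y
  between⇒covered (here _) _ u≺x x≺u = ⊥-elim (asym u≺x x≺u)
  between⇒covered {x = x} (step {v = w} e p) shortest u≺x x≺v with compare x w
  ... | tri< x≺w _ _ = inj₂ (_ , at-head e p , proj₁ (between-edge⇒adjacent e u≺x x≺w))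
  ... | tri≈ _ refl _ = inj₁ (in-tail e (start∈ p))
  ... | tri> _ _ w≺x with between⇒covered p (shortest-tail e shortest) w≺x x≺v
  ... | inj₁ x∈p = inj₁ (in-tail e x∈p)
  ... | inj₂ (y , y∈p , exy) = inj₂ (y , in-tail e y∈p , exy)

  -- Follow q until it passes a; the edge jumping over a has a as a neighbour of its upper end.
  walk-from-between : ∀ {w b l a} (q : W w b l) → Shortest w b l → w ≺ a → a ≺ b → ∃[ m ] m ≤ l × W a b m
  walk-from-between (here _) _ w≺a a≺w = ⊥-elim (asym w≺a a≺w)
  walk-from-between {a = a} (step {v = y} e q) shortest w≺a a≺b with compare a y
  ... | tri< a≺y _ _ = _ , ≤-refl , step (proj₂ (between-edge⇒adjacent e w≺a a≺y)) q
  ... | tri≈ _ refl _ = _ , n≤1+n _ , q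
  ... | tri> _ _ y≺a with walk-from-between q (shortest-tail e shortest) y≺a a≺b
  ... | m , m≤l , q′ = m , m≤n⇒m≤1+n m≤l , q′

  walk-from-between-nonadjacent : ∀ {x b l a} (q : W x b l) → Shortest x b l → x ≺ a → a ≺ b → ¬ E x a →
                                  ∃[ m ] m < l × W a b m
  walk-from-between-nonadjacent (here _) _ x≺a a≺x _ = ⊥-elim (asym x≺a a≺x)
  walk-from-between-nonadjacent {a = a} (step {v = y} e q) shortest x≺a a≺b ¬exa with compare a y
  ... | tri< a≺y _ _ = ⊥-elim (¬exa (E-sym (proj₁ (between-edge⇒adjacent e x≺a a≺y))))
  ... | tri≈ _ refl _ = ⊥-elim (¬exa e)
  ... | tri> _ _ y≺a with walk-from-between q (shortest-tail e shortest) y≺a a≺b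
  ... | m , m≤l , q′ = m , s≤s m≤l , q′

  -- Otherwise a shortest walk from x to v, of length at most l, yields a walk from u to v shorter than l.
  below-start⇒adjacent : ∀ {u v l x} → Shortest u v l → (∀ a b → d a b ≤ l) → x ≺ u → u ≺ v → E x u
  below-start⇒adjacent {u} {v} {l} {x} shortest bounded x≺u u≺v with E? x u
  ... | yes exu = exu
  ... | no ¬exu with walk-from-between-nonadjacent (geodesic x v) (geodesic-shortest x v) x≺u u≺v ¬exu
  ... | m , m<dxv , q = ⊥-elim (<⇒≱ (<-≤-trans m<dxv (bounded x v)) (shortest m q))

module Narrowness {n} {G : Graph n} (O : ClosedLinearOrder G) (connected : Connected G) where

  open Walks G
  open ClosedLinearOrder O
  private module Up = Covering O connected
  private module Down = Covering (reverseOrder O) connected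
  open Distances connected using (d)

  narrow-ascending : ∀ {u v l} (p : W u v l) → Shortest u v l → (∀ a b → d a b ≤ l) → u ≺ v →
                     ∀ x → x ∈W p ⊎ ∃[ y ] y ∈W p × E x y
  narrow-ascending {u} {v} p shortest bounded u≺v x with compare x u
  ... | tri< x≺u _ _ = inj₂ (u , start∈ p , Up.below-start⇒adjacent shortest bounded x≺u u≺v)
  ... | tri≈ _ refl _ = inj₁ (start∈ p)
  ... | tri> _ _ u≺x with compare x v
  ... | tri< x≺v _ _ = Up.between⇒covered p shortest u≺x x≺v
  ... | tri≈ _ refl _ = inj₁ (end∈ p)
  ... | tri> _ _ v≺x = inj₂ (v , end∈ p , Down.below-start⇒adjacent (shortest-reverse shortest) bounded v≺x u≺v)

module _ {n} {G : Graph n} (connected : Connected G) where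

  open Walks G
  open Distances connected

  closed⇒narrow : ClosedLinearOrder G → Narrow G
  closed⇒narrow O {u} {v} p ((_ , shortest) , diameter) x with ClosedLinearOrder.compare O u v
  ... | tri< u≺v _ _ = Narrowness.narrow-ascending O connected p shortest (diameter-bound diameter) u≺v x
  ... | tri> _ _ v≺u = Narrowness.narrow-ascending (reverseOrder O) connected p shortest (diameter-bound diameter) v≺u x
  ... | tri≈ _ refl _ = inj₁ (subst (_∈W p) (sym x≡u) (start∈ p))
    where
    x≡u : x ≡ u
    x≡u = d≡0⇒≡ (n≤0⇒n≡0 (≤-trans (diameter-bound diameter x u) (shortest 0 (here u))))

  closed⇒chordal-clawFree-narrow : IsClosed G → Chordal G × ClawFree G × Narrow G
  closed⇒chordal-clawFree-narrow closed =
    ChordalityAndClawFreeness.closed⇒chordal O , ChordalityAndClawFreeness.closed⇒clawFree O , closed⇒narrow O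
    where
    O : ClosedLinearOrder G
    O = labelingOrder closed

module ChordlessCycles {n} {G : Graph n} (chordal : Chordal G) where

  open Walks G

  -- The cycle x₀ … x₍ₖ₊₃₎ is given by the edges (0,1), (1,2), …, (k+3,0) and by the distinct, non-adjacent
  -- pairs of non-consecutive positions, both listed in lexicographic order of the positions.
  no-chordless-cycle : ∀ {k} (x : Vec V (4 + k)) →
    All (uncurry λ i j → E (lookup x i) (lookup x j)) consecutivePairs →
    All (uncurry λ i j → lookup x i ≢ lookup x j × ¬ E (lookup x i) (lookup x j)) nonConsecutivePairs → ⊥
  no-chordless-cycle {k} x consecutive far = chordless (chordal (4 + k) (m≤m+n 4 k) cycle)
    where
    adjacent : ∀ i j → Next i j → E (lookup x i) (lookup x j)
    adjacent = lookup-filtered-pairs consecutive? consecutive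

    apart : ∀ {i j} → i ≢ j → ¬ Next i j → ¬ Next j i → lookup x i ≢ lookup x j × ¬ E (lookup x i) (lookup x j)
    apart {i} {j} i≢j ¬i→j ¬j→i with nonconsecutive⇒gap i≢j ¬i→j ¬j→i
    ... | inj₁ gap = lookup-filtered-pairs gap? far i j gap
    ... | inj₂ gap with lookup-filtered-pairs gap? far j i gap
    ... | xj≢xi , ¬eji = xj≢xi ∘ sym , ¬eji ∘ E-sym

    injective : ∀ {i j} → lookup x i ≡ lookup x j → i ≡ j
    injective {i} {j} xi≡xj with i Fin.≟ j
    ... | yes i≡j = i≡j
    ... | no i≢j with consecutive? (i , j) | consecutive? (j , i)
    ... | yes i→j | _ = ⊥-elim (E⇒≢ (adjacent i j i→j) xi≡xj)
    ... | no _ | yes j→i = ⊥-elim (E⇒≢ (adjacent j i j→i) (sym xi≡xj))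
    ... | no ¬i→j | no ¬j→i = ⊥-elim (proj₁ (apart i≢j ¬i→j ¬j→i) xi≡xj)

    cycle : Cycle G (4 + k)
    cycle = record { vtx = lookup x ; distinct = injective ; edges = adjacent }

    chordless : HasChord cycle → ⊥
    chordless (i , j , i≢j , ¬i→j , ¬j→i , chord) = proj₂ (apart i≢j ¬i→j ¬j→i) chord

module ClosedLabelingConstruction {n} {G : Graph n} (connected : Connected G)
         (chordal : Chordal G) (clawFree : ClawFree G) (narrow : Narrow G)
         {D′ : ℕ} (diameter : IsDiam G (suc (suc D′))) where

  open Walks G
  open Distances connected
  open ChordlessCycles chordal

  D : ℕ
  D = suc (suc D′)

  Near : V → V → Set
  Near x y = x ≡ y ⊎ E x y

  near? : ∀ x y → Dec (Near x y)
  near? x y = (x Fin.≟ y) ⊎-dec E? x y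

  Simplicial : V → Set
  Simplicial x = ∀ {a b} → E x a → E x b → a ≢ b → E a b

  closedDegree : V → ℕ
  closedDegree x = count (near? x)

  apart-sym : ∀ {a b} → a ≢ b × ¬ E a b → b ≢ a × ¬ E b a
  apart-sym (a≢b , ¬eab) = ≢-sym a≢b , ¬eab ∘ E-sym

  no-claw : ∀ {v a b c} → E v a → E v b → E v c → a ≢ b → a ≢ c → b ≢ c → ¬ E a b → ¬ E a c → ¬ E b c → ⊥
  no-claw eva evb evc a≢b a≢c b≢c ¬ab ¬ac ¬bc =
    clawFree _ _ _ _ (eva , evb , evc , a≢b , a≢c , b≢c , ¬ab , ¬ac , ¬bc)

  diametral-path-dominates : ∀ {a b l} (p : W a b l) → l ≡ D → d a b ≡ D → ∀ x → ∃[ y ] y ∈W p × Near x y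
  diametral-path-dominates {a} {b} p refl dab≡D x
    with narrow p ((p , λ _ q → subst (_≤ _) dab≡D (d-minimal q)) , diameter) x
  ... | inj₁ x∈p = x , x∈p , inj₁ refl
  ... | inj₂ (y , y∈p , exy) = y , y∈p , inj₂ exy

  module Rooted (r : V) where

    level : V → ℕ
    level = d r

    level≤D : ∀ z → level z ≤ D
    level≤D = diameter-bound diameter r

    level-edge : ∀ {a b} → E a b → level b ≤ suc (level a)
    level-edge {a} {b} e = begin
      level b            ≤⟨ d-triangle r a b ⟩
      level a + d a b    ≤⟨ +-monoʳ-≤ (level a) (d-edge e) ⟩
      level a + 1        ≡⟨ +-comm (level a) 1 ⟩
      suc (level a)      ∎
      where open ≤-Reasoning

    near-level-bounds : ∀ {x y} → Near x y → level y ≤ suc (level x) × level x ≤ suc (level y)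
    near-level-bounds (inj₁ refl) = n≤1+n _ , n≤1+n _
    near-level-bounds (inj₂ e) = level-edge e , level-edge (E-sym e)

    near-levels : ∀ {x y s t} → level x ≡ s → level y ≡ t → Near x y → t ≡ s ⊎ suc t ≡ s ⊎ t ≡ suc s
    near-levels {x} {y} refl refl near with <-cmp (level y) (level x) | near-level-bounds near
    ... | tri< y<x _ _ | _ , x≤1+y = inj₂ (inj₁ (≤-antisym y<x x≤1+y))
    ... | tri≈ _ y≡x _ | _ = inj₁ y≡x
    ... | tri> _ _ x<y | y≤1+x , _ = inj₂ (inj₂ (≤-antisym y≤1+x x<y))

    levels-<⇒≢ : ∀ {a b s t} → level a ≡ s → level b ≡ t → s < t → a ≢ b
    levels-<⇒≢ refl refl s<t refl = <-irrefl refl s<t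

    levels-gap⇒¬E : ∀ {a b s t} → level a ≡ s → level b ≡ t → suc s < t → ¬ E a b
    levels-gap⇒¬E refl refl s+1<t e = <⇒≱ s+1<t (level-edge e)

    levels-gap⇒apart : ∀ {a b s t} → level a ≡ s → level b ≡ t → suc s < t → a ≢ b × ¬ E a b
    levels-gap⇒apart ha hb gap = levels-<⇒≢ ha hb (≤-trans (n≤1+n _) gap) , levels-gap⇒¬E ha hb gap

    geodesic-to : ∀ {z l} → level z ≡ l → W r z l
    geodesic-to {z} eq = subst (W r z) eq (geodesic r z)

    ∈-geodesic : ∀ {z l y} (q : W r z l) → level z ≡ l → y ∈W q → ∃[ t ] t ≤ l × y ≡ vertexAt q t × level y ≡ t
    ∈-geodesic q eq y∈q with ∈⇒vertexAt q y∈q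
    ... | t , t≤l , refl = t , t≤l , refl , d-vertexAt-geodesic q eq t t≤l

    parent : ∀ {z j} → level z ≡ suc j → ∃[ p ] E p z × level p ≡ j
    parent {z} {j} eq =
      vertexAt q j ,
      subst (E _) (vertexAt-length q) (vertexAt-edge q j ≤-refl) ,
      d-vertexAt-geodesic q eq j (n≤1+n j)
      where
      q : W r z (suc j)
      q = geodesic-to eq

    near-diametral-geodesic : ∀ {z} (q : W r z D) → level z ≡ D → ∀ x →
                              ∃[ t ] t ≤ D × Near x (vertexAt q t) × level (vertexAt q t) ≡ t
    near-diametral-geodesic q eq x with diametral-path-dominates q refl eq x
    ... | y , y∈q , near with ∈-geodesic q eq y∈q
    ... | t , t≤D , refl , level≡t = t , t≤D , near , level≡t

    -- A second top vertex x′ is near the last edge of a geodesic to x; near its middle vertex we get a claw.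
    top-clique : ∀ {x x′} → level x ≡ D → level x′ ≡ D → x ≢ x′ → E x x′
    top-clique {x} {x′} hx hx′ x≢x′ with E? x x′
    ... | yes e = e
    ... | no ¬e = ⊥-elim (refute (near-diametral-geodesic q hx x′))
      where
      q : W r x D
      q = geodesic-to hx
      w q₀ : V
      w = vertexAt q (suc D′)
      q₀ = vertexAt q D′
      hq₀ : level q₀ ≡ D′
      hq₀ = d-vertexAt-geodesic q hx D′ (≤-trans (n≤1+n _) (n≤1+n _))
      ewx : E w x
      ewx = subst (E w) (vertexAt-length q) (vertexAt-edge q (suc D′) ≤-refl)
      eq₀w : E q₀ w
      eq₀w = vertexAt-edge q D′ (n≤1+n _)
      refute : ∃[ t ] t ≤ D × Near x′ (vertexAt q t) × level (vertexAt q t) ≡ t → ⊥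
      refute (t , t≤D , near , ht) with near-levels hx′ ht near
      ... | inj₁ refl = [ x≢x′ ∘ sym , ¬e ∘ E-sym ]′ (subst (Near x′) (vertexAt-length q) near)
      ... | inj₂ (inj₂ refl) = 1+n≰n t≤D
      ... | inj₂ (inj₁ refl) with near
      ... | inj₁ x′≡w = levels-<⇒≢ ht hx′ ≤-refl (sym x′≡w)
      ... | inj₂ ex′w = no-claw ewx (E-sym ex′w) (E-sym eq₀w) x≢x′
        (≢-sym (levels-<⇒≢ hq₀ hx (n≤1+n _))) (≢-sym (levels-<⇒≢ hq₀ hx′ (n≤1+n _)))
        ¬e (levels-gap⇒¬E hq₀ hx ≤-refl ∘ E-sym) (levels-gap⇒¬E hq₀ hx′ ≤-refl ∘ E-sym)

    top-neighbour-level : ∀ {x a} → level x ≡ D → E x a → level a ≡ suc D′ ⊎ level a ≡ D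
    top-neighbour-level {x} {a} hx e with <-cmp (level a) D
    ... | tri< a<D _ _ = inj₁ (≤-antisym (≤-pred a<D) (≤-pred (subst (_≤ suc (level a)) hx (level-edge (E-sym e)))))
    ... | tri≈ _ a≡D _ = inj₂ a≡D
    ... | tri> _ _ D<a = ⊥-elim (<⇒≱ D<a (level≤D a))

    module ThroughTopEdge {a x} (ha : level a ≡ suc D′) (hx : level x ≡ D) (eax : E a x) where

      q : W r x D
      q = geodesic-to ha ∷ʳ eax

      q-at-a : vertexAt q (suc D′) ≡ a
      q-at-a = trans (vertexAt-∷ʳ (geodesic-to ha) eax (suc D′) ≤-refl) (vertexAt-length (geodesic-to ha))

      a′ : V
      a′ = vertexAt q D′

      ha′ : level a′ ≡ D′
      ha′ = d-vertexAt-geodesic q hx D′ (≤-trans (n≤1+n _) (n≤1+n _))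

      ea′a : E a′ a
      ea′a = subst (E a′) q-at-a (vertexAt-edge q D′ (≤-trans (n<1+n _) (n≤1+n _)))

      -- Otherwise a chordless cycle of length 4, 5 or 6 closes up through b, its parent and the geodesic to a.
      top-neighbours-adjacent : ∀ {b} → level b ≡ suc D′ → E b x → a ≢ b → E a b
      top-neighbours-adjacent {b} hb ebx a≢b with E? a b
      ... | yes eab = eab
      ... | no ¬eab = ⊥-elim (refute (near-diametral-geodesic q hx b′))
        where
        b′ : V
        b′ = proj₁ (parent hb)
        eb′b : E b′ b
        eb′b = proj₁ (proj₂ (parent hb))
        hb′ : level b′ ≡ D′
        hb′ = proj₂ (proj₂ (parent hb))
        ¬ba′ : ¬ E b a′
        ¬ba′ eba′ = no-chordless-cycle (a ∷ x ∷ b ∷ a′ ∷ [])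
          (eax ∷ E-sym ebx ∷ eba′ ∷ ea′a ∷ [])
          ((a≢b , ¬eab) ∷ apart-sym (levels-gap⇒apart ha′ hx ≤-refl) ∷ [])
        ¬ab′ : ¬ E a b′
        ¬ab′ eab′ = no-chordless-cycle (a ∷ x ∷ b ∷ b′ ∷ [])
          (eax ∷ E-sym ebx ∷ E-sym eb′b ∷ E-sym eab′ ∷ [])
          ((a≢b , ¬eab) ∷ apart-sym (levels-gap⇒apart hb′ hx ≤-refl) ∷ [])
        b′≢a′ : b′ ≢ a′
        b′≢a′ b′≡a′ = ¬ba′ (subst (E b) b′≡a′ (E-sym eb′b))
        ¬b′a′ : ¬ E b′ a′
        ¬b′a′ eb′a′ = no-chordless-cycle (a ∷ x ∷ b ∷ b′ ∷ a′ ∷ [])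
          (eax ∷ E-sym ebx ∷ E-sym eb′b ∷ eb′a′ ∷ ea′a ∷ [])
          ( (a≢b , ¬eab)
          ∷ (≢-sym (levels-<⇒≢ hb′ ha ≤-refl) , ¬ab′)
          ∷ apart-sym (levels-gap⇒apart hb′ hx ≤-refl)
          ∷ apart-sym (levels-gap⇒apart ha′ hx ≤-refl)
          ∷ (≢-sym (levels-<⇒≢ ha′ hb ≤-refl) , ¬ba′)
          ∷ [])
        refute : ∃[ t ] t ≤ D × Near b′ (vertexAt q t) × level (vertexAt q t) ≡ t → ⊥
        refute (t , _ , near , ht) with near-levels hb′ ht near
        ... | inj₂ (inj₂ refl) = [ levels-<⇒≢ hb′ ha ≤-refl , ¬ab′ ∘ E-sym ]′ (subst (Near b′) q-at-a near)
        ... | inj₁ refl = [ b′≢a′ , ¬b′a′ ]′ near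
        ... | inj₂ (inj₁ 1+t≡D′) = [ ≢-sym (levels-<⇒≢ ht hb′ t<D′) , ¬b′a″ ]′ near
          where
          t<D′ : t < D′
          t<D′ = ≤-reflexive 1+t≡D′
          a″ : V
          a″ = vertexAt q t
          ea″a′ : E a″ a′
          ea″a′ = subst (λ k → E a″ (vertexAt q k)) 1+t≡D′
                    (vertexAt-edge q t (≤-trans t<D′ (≤-trans (n≤1+n _) (n≤1+n _))))
          ¬b′a″ : ¬ E b′ a″
          ¬b′a″ eb′a″ = no-chordless-cycle (a ∷ x ∷ b ∷ b′ ∷ a″ ∷ a′ ∷ [])
            (eax ∷ E-sym ebx ∷ E-sym eb′b ∷ eb′a″ ∷ ea″a′ ∷ ea′a ∷ [])
            ( (a≢b , ¬eab)
            ∷ (≢-sym (levels-<⇒≢ hb′ ha ≤-refl) , ¬ab′)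
            ∷ apart-sym (levels-gap⇒apart ht ha (s≤s t<D′))
            ∷ apart-sym (levels-gap⇒apart hb′ hx ≤-refl)
            ∷ apart-sym (levels-gap⇒apart ht hx (s≤s (≤-trans t<D′ (n≤1+n _))))
            ∷ apart-sym (levels-gap⇒apart ha′ hx ≤-refl)
            ∷ apart-sym (levels-gap⇒apart ht hb (s≤s t<D′))
            ∷ (≢-sym (levels-<⇒≢ ha′ hb ≤-refl) , ¬ba′)
            ∷ (b′≢a′ , ¬b′a′)
            ∷ [])

      -- Every closed neighbour z of b is one of x: at level D by top-clique, at level D - 1 since otherwise
      -- narrowness along q produces a chordless 4- or 5-cycle.  But a is a neighbour of x and not of b.
      closedDegree-drops : ∀ {b} → level b ≡ D → E x b → ¬ E a b → closedDegree b < closedDegree x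
      closedDegree-drops {b} hb exb ¬eab =
        count-strict (near? b) (near? x) neighbour-of-x {a} (inj₂ (E-sym eax))
          [ levels-<⇒≢ ha hb ≤-refl ∘ sym , ¬eab ∘ E-sym ]′
        where
        neighbour-of-x : ∀ {z} → Near b z → Near x z
        neighbour-of-x (inj₁ refl) = inj₂ exb
        neighbour-of-x {z} (inj₂ ebz) with x Fin.≟ z | top-neighbour-level hb ebz
        ... | yes x≡z | _ = inj₁ x≡z
        ... | no x≢z | inj₂ hz = inj₂ (top-clique hx hz x≢z)
        ... | no x≢z | inj₁ hz with E? x z
        ... | yes exz = inj₂ exz
        ... | no ¬exz = ⊥-elim (refute (near-diametral-geodesic q hx z))
          where
          ¬za : ¬ E z a
          ¬za eza = no-chordless-cycle (a ∷ x ∷ b ∷ z ∷ [])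
            (eax ∷ exb ∷ ebz ∷ eza ∷ [])
            ((levels-<⇒≢ ha hb ≤-refl , ¬eab) ∷ (x≢z , ¬exz) ∷ [])
          a≢z : a ≢ z
          a≢z refl = ¬eab (E-sym ebz)
          refute : ∃[ t ] t ≤ D × Near z (vertexAt q t) × level (vertexAt q t) ≡ t → ⊥
          refute (t , _ , near , ht) with near-levels hz ht near
          ... | inj₂ (inj₂ refl) = [ x≢z ∘ sym , ¬exz ∘ E-sym ]′ (subst (Near z) (vertexAt-length q) near)
          ... | inj₁ refl = [ a≢z ∘ sym , ¬za ]′ (subst (Near z) q-at-a near)
          ... | inj₂ (inj₁ refl) = [ levels-<⇒≢ ht hz ≤-refl ∘ sym , ¬za′ ]′ near
            where
            ¬za′ : ¬ E z a′
            ¬za′ eza′ with E? a z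
            ... | yes eaz = ¬za (E-sym eaz)
            ... | no ¬eaz = no-chordless-cycle (a ∷ x ∷ b ∷ z ∷ a′ ∷ [])
              (eax ∷ exb ∷ ebz ∷ eza′ ∷ ea′a ∷ [])
              ( (levels-<⇒≢ ha hb ≤-refl , ¬eab)
              ∷ (a≢z , ¬eaz)
              ∷ (x≢z , ¬exz)
              ∷ apart-sym (levels-gap⇒apart ha′ hx ≤-refl)
              ∷ apart-sym (levels-gap⇒apart ha′ hb ≤-refl)
              ∷ [])

    -- suc n exceeds every closed degree, so topDegree is minimised at a top vertex.
    private
      topDegree : V → ℕ
      topDegree z with level z ℕ.≟ D
      ... | yes _ = closedDegree z
      ... | no _ = suc n

      topDegree-top : ∀ {z} → level z ≡ D → topDegree z ≡ closedDegree z
      topDegree-top {z} hz with level z ℕ.≟ D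
      ... | yes _ = refl
      ... | no ¬hz = ⊥-elim (¬hz hz)

      topDegree-other : ∀ {z} → level z ≢ D → topDegree z ≡ suc n
      topDegree-other {z} ¬hz with level z ℕ.≟ D
      ... | yes hz = ⊥-elim (¬hz hz)
      ... | no _ = refl

    simplicial-top-vertex : ∀ {v} → level v ≡ D → ∃[ x₀ ] level x₀ ≡ D × Simplicial x₀
    simplicial-top-vertex {v} hv = x₀ , hx₀ , simplicial
      where
      minimum : ∃[ x₀ ] ∀ z → ¬ topDegree z < topDegree x₀
      minimum = argmin <-isStrictTotalOrder v topDegree
      x₀ : V
      x₀ = proj₁ minimum
      minimal : ∀ z → topDegree x₀ ≤ topDegree z
      minimal z = ≮⇒≥ (proj₂ minimum z)
      hx₀ : level x₀ ≡ D
      hx₀ with level x₀ ℕ.≟ D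
      ... | yes hx₀ = hx₀
      ... | no ¬hx₀ = ⊥-elim (1+n≰n (begin
        suc n              ≡⟨ topDegree-other ¬hx₀ ⟨
        topDegree x₀       ≤⟨ minimal v ⟩
        topDegree v        ≡⟨ topDegree-top hv ⟩
        closedDegree v     ≤⟨ count≤size (near? v) ⟩
        n                  ∎))
        where open ≤-Reasoning
      minimal-top : ∀ {z} → level z ≡ D → closedDegree x₀ ≤ closedDegree z
      minimal-top {z} hz = subst₂ _≤_ (topDegree-top hx₀) (topDegree-top hz) (minimal z)
      simplicial : Simplicial x₀
      simplicial {a} {b} ea eb a≢b with top-neighbour-level hx₀ ea | top-neighbour-level hx₀ eb | E? a b
      ... | _ | _ | yes eab = eab
      ... | inj₂ ha | inj₂ hb | no _ = top-clique ha hb a≢b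
      ... | inj₁ ha | inj₁ hb | no _ = ThroughTopEdge.top-neighbours-adjacent ha hx₀ (E-sym ea) hb (E-sym eb) a≢b
      ... | inj₁ ha | inj₂ hb | no ¬eab =
        ⊥-elim (<⇒≱ (ThroughTopEdge.closedDegree-drops ha hx₀ (E-sym ea) hb eb ¬eab) (minimal-top hb))
      ... | inj₂ ha | inj₁ hb | no ¬eab =
        ⊥-elim (<⇒≱ (ThroughTopEdge.closedDegree-drops hb hx₀ (E-sym eb) ha ea (¬eab ∘ E-sym)) (minimal-top ha))

    module SimplicialRoot (simplicial-root : Simplicial r) {u} (hu : level u ≡ D) where

      Q : W r u D
      Q = geodesic-to hu

      q : ℕ → V
      q = vertexAt Q

      level-q : ∀ k → k ≤ D → level (q k) ≡ k
      level-q = d-vertexAt-geodesic Q hu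

      edge-q : ∀ k → suc k ≤ D → E (q k) (q (suc k))
      edge-q = vertexAt-edge Q

      near-q-levels : ∀ {a t} → t ≤ D → Near a (q t) → t ≤ suc (level a) × level a ≤ suc t
      near-q-levels {a} {t} t≤D near =
        subst (λ k → k ≤ suc (level a) × level a ≤ suc k) (level-q t t≤D) (near-level-bounds near)

      LevelClique : ℕ → Set
      LevelClique i = ∀ {y z} → level y ≡ i → level z ≡ i → y ≢ z → E y z

      level-clique-0 : LevelClique 0
      level-clique-0 hy hz y≢z = ⊥-elim (y≢z (trans (sym (d≡0⇒≡ hy)) (d≡0⇒≡ hz)))

      level-clique-1 : LevelClique 1
      level-clique-1 hy hz y≢z = simplicial-root (d≡1⇒E hy) (d≡1⇒E hz) y≢z

      module Step (i : ℕ) (clique : LevelClique (suc i)) (2+i≤D : suc (suc i) ≤ D) where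

        1+i≤D : suc i ≤ D
        1+i≤D = ≤-trans (n≤1+n _) 2+i≤D

        i≤D : i ≤ D
        i≤D = ≤-trans (n≤1+n _) 1+i≤D

        q₀ q₁ q₂ : V
        q₀ = q i
        q₁ = q (suc i)
        q₂ = q (suc (suc i))

        h₀ : level q₀ ≡ i
        h₀ = level-q i i≤D
        h₁ : level q₁ ≡ suc i
        h₁ = level-q (suc i) 1+i≤D
        h₂ : level q₂ ≡ suc (suc i)
        h₂ = level-q (suc (suc i)) 2+i≤D

        e₀₁ : E q₀ q₁
        e₀₁ = edge-q i 1+i≤D
        e₁₂ : E q₁ q₂
        e₁₂ = edge-q (suc i) 2+i≤D

        -- Narrowness puts z near q₁, q₂ or q₃; near q₁ or q₃ a claw or a chordless 4- or 5-cycle appears.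
        near-q₂ : ∀ {z} → level z ≡ suc (suc i) → Near z q₂
        near-q₂ {z} hz with near? z q₂
        ... | yes near = near
        ... | no ¬near = ⊥-elim (refute (near-diametral-geodesic Q hu z))
          where
          refute : ∃[ t ] t ≤ D × Near z (q t) × level (q t) ≡ t → ⊥
          refute (t , t≤D , near , ht) with near-levels hz ht near
          ... | inj₁ refl = ¬near near
          ... | inj₂ (inj₁ refl) = [ levels-<⇒≢ h₁ hz ≤-refl ∘ sym , claw-at-q₁ ]′ near
            where
            claw-at-q₁ : ¬ E z q₁
            claw-at-q₁ ezq₁ = no-claw (E-sym e₀₁) e₁₂ (E-sym ezq₁)
              (levels-<⇒≢ h₀ h₂ (n≤1+n _)) (levels-<⇒≢ h₀ hz (n≤1+n _)) (¬near ∘ inj₁ ∘ sym)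
              (levels-gap⇒¬E h₀ h₂ ≤-refl) (levels-gap⇒¬E h₀ hz ≤-refl) (¬near ∘ inj₂ ∘ E-sym)
          ... | inj₂ (inj₂ refl) = [ levels-<⇒≢ hz h₃ ≤-refl , ¬ezq₃ ]′ near
            where
            h₃ : level (q t) ≡ t
            h₃ = level-q _ t≤D
            e₂₃ : E q₂ (q t)
            e₂₃ = edge-q _ t≤D
            ¬ezq₃ : ¬ E z (q t)
            ¬ezq₃ ezq₃ with suc t ℕ.≤? D
            ... | yes 4+i≤D = no-claw (E-sym ezq₃) (E-sym e₂₃) (edge-q _ 4+i≤D)
              (¬near ∘ inj₁) (levels-<⇒≢ hz h₄ (n≤1+n _)) (levels-<⇒≢ h₂ h₄ (n≤1+n _))
              (¬near ∘ inj₂) (levels-gap⇒¬E hz h₄ ≤-refl) (levels-gap⇒¬E h₂ h₄ ≤-refl)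
              where
              h₄ : level (q (suc t)) ≡ suc t
              h₄ = level-q _ 4+i≤D
            ... | no _ with E? z q₁
            ... | yes ezq₁ = no-chordless-cycle (q₁ ∷ z ∷ q t ∷ q₂ ∷ [])
              (E-sym ezq₁ ∷ ezq₃ ∷ E-sym e₂₃ ∷ E-sym e₁₂ ∷ [])
              (levels-gap⇒apart h₁ h₃ ≤-refl ∷ (¬near ∘ inj₁ , ¬near ∘ inj₂) ∷ [])
            ... | no ¬ezq₁ with parent hz
            ... | p , epz , hp with E? p q₂
            ... | yes epq₂ = no-chordless-cycle (p ∷ z ∷ q t ∷ q₂ ∷ [])
              (epz ∷ ezq₃ ∷ E-sym e₂₃ ∷ E-sym epq₂ ∷ [])
              (levels-gap⇒apart hp h₃ ≤-refl ∷ (¬near ∘ inj₁ , ¬near ∘ inj₂) ∷ [])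
            ... | no ¬epq₂ = no-chordless-cycle (p ∷ z ∷ q t ∷ q₂ ∷ q₁ ∷ [])
              (epz ∷ ezq₃ ∷ E-sym e₂₃ ∷ E-sym e₁₂ ∷ E-sym (clique hp h₁ p≢q₁) ∷ [])
              ( levels-gap⇒apart hp h₃ ≤-refl
              ∷ (levels-<⇒≢ hp h₂ ≤-refl , ¬epq₂)
              ∷ (¬near ∘ inj₁ , ¬near ∘ inj₂)
              ∷ (≢-sym (levels-<⇒≢ h₁ hz ≤-refl) , ¬ezq₁)
              ∷ apart-sym (levels-gap⇒apart h₁ h₃ ≤-refl)
              ∷ [])
              where
              p≢q₁ : p ≢ q₁
              p≢q₁ refl = ¬ezq₁ (E-sym epz)

        near-below : ∀ {a t} → level a ≡ suc (suc i) → t ≤ suc i → Near a (q t) → Near a q₁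
        near-below {a} {t} ha t≤1+i near =
          subst (Near a ∘ q)
            (≤-antisym t≤1+i (≤-pred (subst (_≤ suc t) ha (proj₂ (near-q-levels (≤-trans t≤1+i 1+i≤D) near)))))
            near

        not-near-far-below : ∀ {a t} → level a ≡ suc (suc i) → t ≤ i → ¬ Near a (q t)
        not-near-far-below {a} {t} ha t≤i near =
          1+n≰n (≤-trans (≤-pred (subst (_≤ suc t) ha (proj₂ (near-q-levels (≤-trans t≤i i≤D) near)))) t≤i)

        near-above : ∀ {a t} → level a ≡ suc (suc i) → 3 + i ≤ t → t ≤ D → Near a (q t) → Near a (q (3 + i))
        near-above {a} {t} ha 3+i≤t t≤D near =
          subst (Near a ∘ q) (≤-antisym (subst (t ≤_) (cong suc ha) (proj₁ (near-q-levels t≤D near))) 3+i≤t) near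

        -- Two non-adjacent vertices x, y of level i + 2, both adjacent to q₂, with x but not y adjacent to q₁:
        -- rerouting Q through x (or through y and its parent) gives a diametral path that the other one misses.
        module OneSided {x y} (hx : level x ≡ suc (suc i)) (hy : level y ≡ suc (suc i))
                        (x≢y : x ≢ y) (¬exy : ¬ E x y) (eq₁x : E q₁ x) where

          ¬eq₁y : ¬ E q₁ y
          ¬eq₁y eq₁y = no-claw eq₁x eq₁y (E-sym e₀₁) x≢y
            (≢-sym (levels-<⇒≢ h₀ hx (n≤1+n _))) (≢-sym (levels-<⇒≢ h₀ hy (n≤1+n _)))
            ¬exy (levels-gap⇒¬E h₀ hx ≤-refl ∘ E-sym) (levels-gap⇒¬E h₀ hy ≤-refl ∘ E-sym)

          y-far-from-q₁ : ¬ Near y q₁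
          y-far-from-q₁ = [ ≢-sym (levels-<⇒≢ h₁ hy ≤-refl) , ¬eq₁y ∘ E-sym ]′

          p : V
          p = proj₁ (parent hy)

          epy : E p y
          epy = proj₁ (proj₂ (parent hy))

          hp : level p ≡ suc i
          hp = proj₂ (proj₂ (parent hy))

          epq₁ : E p q₁
          epq₁ = clique hp h₁ λ p≡q₁ → ¬eq₁y (subst (λ v → E v y) p≡q₁ epy)

          ¬epx : ¬ E p x
          ¬epx epx with parent hp
          ... | p′ , ep′p , hp′ = no-claw epx epy (E-sym ep′p) x≢y
            (≢-sym (levels-<⇒≢ hp′ hx (n≤1+n _))) (≢-sym (levels-<⇒≢ hp′ hy (n≤1+n _)))
            ¬exy (levels-gap⇒¬E hp′ hx ≤-refl ∘ E-sym) (levels-gap⇒¬E hp′ hy ≤-refl ∘ E-sym)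

          eq₀p : E q₀ p
          eq₀p with E? q₀ p
          ... | yes eq₀p = eq₀p
          ... | no ¬eq₀p = ⊥-elim (no-claw eq₁x (E-sym epq₁) (E-sym e₀₁)
            (≢-sym (levels-<⇒≢ hp hx ≤-refl)) (≢-sym (levels-<⇒≢ h₀ hx (n≤1+n _))) (≢-sym (levels-<⇒≢ h₀ hp ≤-refl))
            (¬epx ∘ E-sym) (levels-gap⇒¬E h₀ hx ≤-refl ∘ E-sym) (¬eq₀p ∘ E-sym))

          last-level : suc (suc i) ≡ D → ⊥
          last-level 2+i≡D = y-not-dominated (diametral-path-dominates R 2+i≡D (trans hx 2+i≡D) y)
            where
            R : W r x (suc (suc i))
            R = take Q (suc i) 1+i≤D ∷ʳ eq₁x
            y-not-dominated : ∃[ z ] z ∈W R × Near y z → ⊥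
            y-not-dominated (z , z∈R , near) with ∈-∷ʳ⁻ (take Q (suc i) 1+i≤D) eq₁x z∈R
            ... | inj₂ refl = [ x≢y ∘ sym , ¬exy ∘ E-sym ]′ near
            ... | inj₁ z∈take with ∈-take⁻ Q (suc i) 1+i≤D z∈take
            ... | t , t≤1+i , refl = y-far-from-q₁ (near-below hy t≤1+i near)

          module _ (3+i≤D : 3 + i ≤ D) where

            q₃ : V
            q₃ = q (3 + i)

            h₃ : level q₃ ≡ 3 + i
            h₃ = level-q _ 3+i≤D

            both-off-q₃ : E x q₂ → E y q₂ → ¬ E q₃ x → ¬ E q₃ y → ⊥
            both-off-q₃ exq₂ eyq₂ ¬eq₃x ¬eq₃y = no-claw (E-sym exq₂) (E-sym eyq₂) (edge-q _ 3+i≤D) x≢y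
              (levels-<⇒≢ hx h₃ ≤-refl) (levels-<⇒≢ hy h₃ ≤-refl) ¬exy (¬eq₃x ∘ E-sym) (¬eq₃y ∘ E-sym)

            both-on-q₃ : E q₃ x → E q₃ y → ⊥
            both-on-q₃ eq₃x eq₃y = no-chordless-cycle (x ∷ q₁ ∷ p ∷ y ∷ q₃ ∷ [])
              (E-sym eq₁x ∷ E-sym epq₁ ∷ epy ∷ E-sym eq₃y ∷ eq₃x ∷ [])
              ( (≢-sym (levels-<⇒≢ hp hx ≤-refl) , ¬epx ∘ E-sym)
              ∷ (x≢y , ¬exy)
              ∷ (levels-<⇒≢ h₁ hy ≤-refl , ¬eq₁y)
              ∷ levels-gap⇒apart h₁ h₃ ≤-refl
              ∷ levels-gap⇒apart hp h₃ ≤-refl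
              ∷ [])

            through-x : E q₃ x → ¬ E q₃ y → ⊥
            through-x eq₃x ¬eq₃y =
              y-not-dominated (diametral-path-dominates R (m+[k+[n∸[k+m]]]≡n (suc i) 2 3+i≤D) hu y)
              where
              R : W r u (suc i + (2 + (D ∸ (3 + i))))
              R = take Q (suc i) 1+i≤D ++ step eq₁x (step (E-sym eq₃x) (drop Q (3 + i)))
              y-not-dominated : ∃[ z ] z ∈W R × Near y z → ⊥
              y-not-dominated (z , z∈R , near) with ∈-++⁻ (take Q (suc i) 1+i≤D) _ z∈R
              ... | inj₁ z∈take with ∈-take⁻ Q (suc i) 1+i≤D z∈take
              ... | t , t≤1+i , refl = y-far-from-q₁ (near-below hy t≤1+i near)
              y-not-dominated (z , z∈R , near) | inj₂ z∈R′ with ∈-step⁻ eq₁x _ z∈R′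
              ... | inj₁ refl = y-far-from-q₁ near
              ... | inj₂ z∈R″ with ∈-step⁻ (E-sym eq₃x) _ z∈R″
              ... | inj₁ refl = [ x≢y ∘ sym , ¬exy ∘ E-sym ]′ near
              ... | inj₂ z∈drop with ∈-drop⁻ Q (3 + i) 3+i≤D z∈drop
              ... | t , 3+i≤t , t≤D , refl = [ levels-<⇒≢ hy h₃ ≤-refl , ¬eq₃y ∘ E-sym ]′ (near-above hy 3+i≤t t≤D near)

            through-y : ¬ E q₃ x → E q₃ y → ⊥
            through-y ¬eq₃x eq₃y =
              x-not-dominated (diametral-path-dominates R (m+[k+[n∸[k+m]]]≡n i 3 3+i≤D) hu x)
              where
              R : W r u (i + (3 + (D ∸ (3 + i))))
              R = take Q i i≤D ++ step eq₀p (step epy (step (E-sym eq₃y) (drop Q (3 + i))))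
              x-not-dominated : ∃[ z ] z ∈W R × Near x z → ⊥
              x-not-dominated (z , z∈R , near) with ∈-++⁻ (take Q i i≤D) _ z∈R
              ... | inj₁ z∈take with ∈-take⁻ Q i i≤D z∈take
              ... | t , t≤i , refl = not-near-far-below hx t≤i near
              x-not-dominated (z , z∈R , near) | inj₂ z∈R′ with ∈-step⁻ eq₀p _ z∈R′
              ... | inj₁ refl = not-near-far-below hx ≤-refl near
              ... | inj₂ z∈R″ with ∈-step⁻ epy _ z∈R″
              ... | inj₁ refl = [ levels-<⇒≢ hp hx ≤-refl ∘ sym , ¬epx ∘ E-sym ]′ near
              ... | inj₂ z∈R‴ with ∈-step⁻ (E-sym eq₃y) _ z∈R‴
              ... | inj₁ refl = [ x≢y , ¬exy ]′ near
              ... | inj₂ z∈drop with ∈-drop⁻ Q (3 + i) 3+i≤D z∈drop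
              ... | t , 3+i≤t , t≤D , refl = [ levels-<⇒≢ hx h₃ ≤-refl , ¬eq₃x ∘ E-sym ]′ (near-above hx 3+i≤t t≤D near)

          impossible : E x q₂ → E y q₂ → ⊥
          impossible exq₂ eyq₂ with 3 + i ℕ.≤? D
          ... | no 3+i≰D = last-level (≤-antisym 2+i≤D (≤-pred (≰⇒> 3+i≰D)))
          ... | yes 3+i≤D with E? (q₃ 3+i≤D) x | E? (q₃ 3+i≤D) y
          ... | no ¬eq₃x | no ¬eq₃y = both-off-q₃ 3+i≤D exq₂ eyq₂ ¬eq₃x ¬eq₃y
          ... | yes eq₃x | yes eq₃y = both-on-q₃ 3+i≤D eq₃x eq₃y
          ... | yes eq₃x | no ¬eq₃y = through-x 3+i≤D eq₃x ¬eq₃y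
          ... | no ¬eq₃x | yes eq₃y = through-y 3+i≤D ¬eq₃x eq₃y

        next-level-clique : LevelClique (suc (suc i))
        next-level-clique {x} {y} hx hy x≢y with E? x y
        ... | yes exy = exy
        ... | no ¬exy = ⊥-elim (both-near (near-q₂ hx) (near-q₂ hy))
          where
          both-near : Near x q₂ → Near y q₂ → ⊥
          both-near (inj₁ refl) (inj₁ y≡q₂) = x≢y (sym y≡q₂)
          both-near (inj₁ refl) (inj₂ eyq₂) = ¬exy (E-sym eyq₂)
          both-near (inj₂ exq₂) (inj₁ refl) = ¬exy exq₂
          both-near (inj₂ exq₂) (inj₂ eyq₂) with E? q₁ x | E? q₁ y
          ... | yes eq₁x | _ = OneSided.impossible hx hy x≢y ¬exy eq₁x exq₂ eyq₂
          ... | no _ | yes eq₁y = OneSided.impossible hy hx (≢-sym x≢y) (¬exy ∘ E-sym) eq₁y eyq₂ exq₂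
          ... | no ¬eq₁x | no ¬eq₁y = no-claw (E-sym exq₂) (E-sym eyq₂) (E-sym e₁₂) x≢y
            (≢-sym (levels-<⇒≢ h₁ hx ≤-refl)) (≢-sym (levels-<⇒≢ h₁ hy ≤-refl))
            ¬exy (¬eq₁x ∘ E-sym) (¬eq₁y ∘ E-sym)

      level-clique : ∀ k → LevelClique k
      level-clique zero = level-clique-0
      level-clique (suc zero) = level-clique-1
      level-clique (suc (suc i)) = extend (level-clique (suc i)) (suc (suc i) ℕ.≤? D)
        where
        extend : LevelClique (suc i) → Dec (suc (suc i) ≤ D) → LevelClique (suc (suc i))
        extend clique (yes 2+i≤D) = Step.next-level-clique i clique 2+i≤D
        extend _ (no 2+i≰D) hy _ _ = ⊥-elim (2+i≰D (subst (_≤ D) hy (level≤D _)))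

      same-level⇒E : ∀ {x y} → level x ≡ level y → x ≢ y → E x y
      same-level⇒E {x} eq x≢y = level-clique (level x) refl (sym eq) x≢y

      Up Down : V → V → Set
      Up x y = E x y × level y ≡ suc (level x)
      Down x y = E x y × suc (level y) ≡ level x

      up? : ∀ x y → Dec (Up x y)
      up? x y = E? x y ×-dec (level y ℕ.≟ suc (level x))

      down? : ∀ x y → Dec (Down x y)
      down? x y = E? x y ×-dec (suc (level y) ℕ.≟ level x)

      upDegree downDegree : V → ℕ
      upDegree x = count (up? x)
      downDegree x = count (down? x)

      -- Up y ⊆ Up x by a 4-cycle through k, Down x ⊆ Down y by a claw at x.
      up-dominates : ∀ {x y k} → level x ≡ level y → Up x k → ¬ E y k →
                     upDegree y < upDegree x × downDegree x ≤ downDegree y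
      up-dominates {x} {y} {k} hxy (exk , hk) ¬eyk =
        count-strict (up? y) (up? x) Up-y⊆Up-x (exk , hk) (¬eyk ∘ proj₁) ,
        count-mono (down? x) (down? y) Down-x⊆Down-y
        where
        exy : E x y
        exy = same-level⇒E hxy λ { refl → ¬eyk exk }
        Up-y⊆Up-x : ∀ {m} → Up y m → Up x m
        Up-y⊆Up-x {m} (eym , hm) with E? x m
        ... | yes exm = exm , trans hm (cong suc (sym hxy))
        ... | no ¬exm = ⊥-elim (no-chordless-cycle (x ∷ k ∷ m ∷ y ∷ [])
          (exk ∷ same-level⇒E (trans hk (trans (cong suc hxy) (sym hm))) (λ { refl → ¬eyk eym })
               ∷ E-sym eym ∷ E-sym exy ∷ [])
          ( (levels-<⇒≢ refl (trans hm (cong suc (sym hxy))) ≤-refl , ¬exm)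
          ∷ (≢-sym (levels-<⇒≢ (sym hxy) hk ≤-refl) , ¬eyk ∘ E-sym)
          ∷ []))
        Down-x⊆Down-y : ∀ {p} → Down x p → Down y p
        Down-x⊆Down-y {p} (exp , hp) with E? y p
        ... | yes eyp = eyp , trans hp hxy
        ... | no ¬eyp = ⊥-elim (no-claw exp exy exk
          (levels-<⇒≢ refl (trans (sym hxy) (sym hp)) ≤-refl) (levels-<⇒≢ refl (trans hk (cong suc (sym hp))) (n≤1+n _))
          (levels-<⇒≢ (sym hxy) hk ≤-refl)
          (¬eyp ∘ E-sym) (levels-gap⇒¬E refl (trans hk (cong suc (sym hp))) ≤-refl) ¬eyk)

      -- Down y ⊆ Down x by a 4-cycle through p, Up x ⊆ Up y by a claw at x.
      down-dominates : ∀ {x y p} → level x ≡ level y → Down x p → ¬ E y p →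
                       downDegree y < downDegree x × upDegree x ≤ upDegree y
      down-dominates {x} {y} {p} hxy (exp , hp) ¬eyp =
        count-strict (down? y) (down? x) Down-y⊆Down-x (exp , hp) (¬eyp ∘ proj₁) ,
        count-mono (up? x) (up? y) Up-x⊆Up-y
        where
        exy : E x y
        exy = same-level⇒E hxy λ { refl → ¬eyp exp }
        Down-y⊆Down-x : ∀ {m} → Down y m → Down x m
        Down-y⊆Down-x {m} (eym , hm) with E? x m
        ... | yes exm = exm , trans hm (sym hxy)
        ... | no ¬exm = ⊥-elim (no-chordless-cycle (x ∷ p ∷ m ∷ y ∷ [])
          (exp ∷ same-level⇒E (suc-injective (trans hp (trans hxy (sym hm)))) (λ { refl → ¬eyp eym })
               ∷ E-sym eym ∷ E-sym exy ∷ [])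
          ( (≢-sym (levels-<⇒≢ {m} refl (sym (trans hm (sym hxy))) ≤-refl) , ¬exm)
          ∷ (levels-<⇒≢ {p} refl (sym (trans hp hxy)) ≤-refl , ¬eyp ∘ E-sym)
          ∷ []))
        Up-x⊆Up-y : ∀ {k} → Up x k → Up y k
        Up-x⊆Up-y {k} (exk , hk) with E? y k
        ... | yes eyk = eyk , trans hk (cong suc hxy)
        ... | no ¬eyk = ⊥-elim (no-claw exp exy exk
          (levels-<⇒≢ refl (trans (sym hxy) (sym hp)) ≤-refl) (levels-<⇒≢ refl (trans hk (cong suc (sym hp))) (n≤1+n _))
          (levels-<⇒≢ (sym hxy) hk ≤-refl)
          (¬eyp ∘ E-sym) (levels-gap⇒¬E refl (trans hk (cong suc (sym hp))) ≤-refl) ¬eyk)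

      M : ℕ
      M = suc (n + n)

      offset : V → ℕ
      offset x = n + upDegree x ∸ downDegree x

      -- Vertices are keyed by level first; inside a level the offset lies in [0, M).
      key : V → ℕ
      key x = level x * M + offset x

      offset<M : ∀ x → offset x < M
      offset<M x = s≤s (≤-trans (m∸n≤m (n + upDegree x) (downDegree x)) (+-monoʳ-≤ n (count≤size (up? x))))

      key-level : ∀ {a b} → level a < level b → key a < key b
      key-level {a} {b} a<b = begin-strict
        level a * M + offset a  <⟨ +-monoʳ-< (level a * M) (offset<M a) ⟩
        level a * M + M         ≡⟨ +-comm (level a * M) M ⟩
        suc (level a) * M       ≤⟨ *-monoˡ-≤ M a<b ⟩
        level b * M             ≤⟨ m≤m+n (level b * M) (offset b) ⟩
        key b                   ∎
        where open ≤-Reasoning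

      key-offset : ∀ {a b} → level a ≡ level b → offset a < offset b → key a < key b
      key-offset {a} {b} hab a<b = subst (λ l → l * M + offset a < key b) (sym hab) (+-monoʳ-< (level b * M) a<b)

      offset-up : ∀ {x y} → upDegree y < upDegree x × downDegree x ≤ downDegree y → offset y < offset x
      offset-up {x} {y} (up< , down≤) = begin-strict
        n + upDegree y ∸ downDegree y  ≤⟨ ∸-monoʳ-≤ (n + upDegree y) down≤ ⟩
        n + upDegree y ∸ downDegree x  <⟨ ∸-monoˡ-< (+-monoʳ-< n up<) (≤-trans (count≤size (down? x)) (m≤m+n n _)) ⟩
        n + upDegree x ∸ downDegree x  ∎
        where open ≤-Reasoning

      offset-down : ∀ {x y} → downDegree y < downDegree x × upDegree x ≤ upDegree y → offset x < offset y
      offset-down {x} {y} (down< , up≤) = begin-strict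
        n + upDegree x ∸ downDegree x  ≤⟨ ∸-monoˡ-≤ (downDegree x) (+-monoʳ-≤ n up≤) ⟩
        n + upDegree y ∸ downDegree x  <⟨ ∸-monoʳ-< down< (≤-trans (count≤size (down? x)) (m≤m+n n _)) ⟩
        n + upDegree y ∸ downDegree y  ∎
        where open ≤-Reasoning

      down-separates : ∀ {x y p} → level x ≡ level y → Down x p → ¬ E y p → key x < key y
      down-separates hxy down ¬eyp = key-offset hxy (offset-down (down-dominates hxy down ¬eyp))

      up-separates : ∀ {x y k} → level x ≡ level y → Up x k → ¬ E y k → key y < key x
      up-separates hxy up ¬eyk = key-offset (sym hxy) (offset-up (up-dominates hxy up ¬eyk))

      key-separates : ∀ {i j k} → E j i → E i k → j ≢ k → ¬ E j k →
                      (key j < key i × key i < key k) ⊎ (key k < key i × key i < key j)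
      key-separates {i} {j} {k} eji eik j≢k ¬ejk
        with near-levels refl refl (inj₂ (E-sym eji)) | near-levels refl refl (inj₂ eik)
      ... | inj₁ j≡i | inj₁ k≡i = ⊥-elim (¬ejk (same-level⇒E (trans j≡i (sym k≡i)) j≢k))
      ... | inj₁ j≡i | inj₂ (inj₁ k<i) = inj₂ (key-level (≤-reflexive k<i) , down-separates (sym j≡i) (eik , k<i) ¬ejk)
      ... | inj₁ j≡i | inj₂ (inj₂ i<k) = inj₁ (up-separates (sym j≡i) (eik , i<k) ¬ejk , key-level (≤-reflexive (sym i<k)))
      ... | inj₂ (inj₁ j<i) | inj₁ k≡i =
        inj₁ (key-level (≤-reflexive j<i) , down-separates (sym k≡i) (E-sym eji , j<i) (¬ejk ∘ E-sym))
      ... | inj₂ (inj₂ i<j) | inj₁ k≡i =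
        inj₂ (up-separates (sym k≡i) (E-sym eji , i<j) (¬ejk ∘ E-sym) , key-level (≤-reflexive (sym i<j)))
      ... | inj₂ (inj₁ j<i) | inj₂ (inj₂ i<k) = inj₁ (key-level (≤-reflexive j<i) , key-level (≤-reflexive (sym i<k)))
      ... | inj₂ (inj₂ i<j) | inj₂ (inj₁ k<i) = inj₂ (key-level (≤-reflexive k<i) , key-level (≤-reflexive (sym i<j)))
      ... | inj₂ (inj₁ j<i) | inj₂ (inj₁ k<i) = ⊥-elim (¬ejk (same-level⇒E (suc-injective (trans j<i (sym k<i))) j≢k))
      ... | inj₂ (inj₂ i<j) | inj₂ (inj₂ i<k) = ⊥-elim (¬ejk (same-level⇒E (trans i<j (sym i<k)) j≢k))

      closed : IsClosed G
      closed = σ , closed-at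
        where
        _⊏_ : V → V → Set
        a ⊏ b = key a < key b ⊎ (key a ≡ key b × toℕ a < toℕ b)
        keyOrder : IsStrictTotalOrder _≡_ _⊏_
        keyOrder = pullback (λ a → key a , toℕ a) (λ (_ , eq) → Fin.toℕ-injective eq)
                            (×-isStrictTotalOrder <-isStrictTotalOrder <-isStrictTotalOrder)
        σ : Permutation′ n
        σ = proj₁ (linearization keyOrder)
        σ-mono : ∀ {a b} → key a < key b → σ ⟨$⟩ʳ a Fin.< σ ⟨$⟩ʳ b
        σ-mono a<b = proj₂ (linearization keyOrder) (inj₁ a<b)
        closed-at : ClosedLabeling G σ
        closed-at i j k eji eik j≢k same-side with E? j k
        ... | yes ejk = ejk
        ... | no ¬ejk with key-separates eji eik j≢k ¬ejk | same-side
        ... | inj₁ (j<i , _) | inj₁ (i<j , _) = ⊥-elim (<-asym i<j (σ-mono j<i))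
        ... | inj₁ (_ , i<k) | inj₂ (_ , k<i) = ⊥-elim (<-asym k<i (σ-mono i<k))
        ... | inj₂ (k<i , _) | inj₁ (_ , i<k) = ⊥-elim (<-asym i<k (σ-mono k<i))
        ... | inj₂ (_ , i<j) | inj₂ (j<i , _) = ⊥-elim (<-asym j<i (σ-mono i<j))

diameter-exists : ∀ {n} {G : Graph n} → Connected G → Fin n → ∃[ D ] IsDiam G D
diameter-exists {G = G} connected v =
  eccentricity peripheral , bounded , peripheral , farthest peripheral , d-isDist peripheral _
  where
  open Distances connected
  argmax : (f : Fin _ → ℕ) → ∃[ i ] ∀ j → ¬ f i < f j
  argmax = argmin (Flip.isStrictTotalOrder <-isStrictTotalOrder) v
  farthest : Fin _ → Fin _
  farthest u = proj₁ (argmax (d u))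
  eccentricity : Fin _ → ℕ
  eccentricity u = d u (farthest u)
  peripheral : Fin _
  peripheral = proj₁ (argmax eccentricity)
  bounded : ∀ a b m → IsDist G a b m → m ≤ eccentricity peripheral
  bounded a b m dist = subst (_≤ eccentricity peripheral) (isDist⇒≡d dist)
    (≤-trans (≮⇒≥ (proj₂ (argmax (d a)) b)) (≮⇒≥ (proj₂ (argmax eccentricity) a)))

small-diameter⇒closed : ∀ {n} {G : Graph n} → Connected G → ∀ {D} → IsDiam G D → D ≤ 1 → IsClosed G
small-diameter⇒closed connected diameter D≤1 = Permutation.id , λ _ j k _ _ j≢k _ →
  d≡1⇒E (≤-antisym (≤-trans (diameter-bound diameter j k) D≤1) (n≢0⇒n>0 (j≢k ∘ d≡0⇒≡)))
  where open Distances connected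

chordal-clawFree-narrow⇒closed : ∀ {n} {G : Graph n} → Connected G →
                                 Chordal G → ClawFree G → Narrow G → IsClosed G
chordal-clawFree-narrow⇒closed {zero} _ _ _ _ = Permutation.id , λ ()
chordal-clawFree-narrow⇒closed {suc _} connected chordal clawFree narrow with diameter-exists connected Fin.zero
... | zero , diameter = small-diameter⇒closed connected diameter z≤n
... | suc zero , diameter = small-diameter⇒closed connected diameter ≤-refl
... | suc (suc D′) , diameter@(_ , u , v , duv) = Rooted.SimplicialRoot.closed x₀ x₀-simplicial hu
  where
  open Distances connected
  open ClosedLabelingConstruction connected chordal clawFree narrow diameter
  x₀-top : ∃[ x₀ ] d u x₀ ≡ D × Simplicial x₀
  x₀-top = Rooted.simplicial-top-vertex u (isDist⇒≡d duv)
  x₀ : Fin _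
  x₀ = proj₁ x₀-top
  x₀-simplicial : Simplicial x₀
  x₀-simplicial = proj₂ (proj₂ x₀-top)
  hu : d x₀ u ≡ D
  hu = trans (d-sym x₀ u) (proj₁ (proj₂ x₀-top))

theorem1p4 : ∀ (n : ℕ) (G : Graph n) → Connected G →
    (IsClosed G ⇔ (Chordal G × ClawFree G × Narrow G))
theorem1p4 n G connected = mk⇔
  (closed⇒chordal-clawFree-narrow connected)
  (λ (chordal , clawFree , narrow) → chordal-clawFree-narrow⇒closed connected chordal clawFree narrow)
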